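{- There exists an SBGDD$_0$ of type $5^8$.
   Context: For a multiset $\mathcal{B}$ of subsets of a set $V$ and $X \subseteq V$, the frequency of $X$ is the number of members of $\mathcal{B}$ (counted with multiplicity) containing $X$. An SBGDD$_\mu$ of type $g^u$ is a triple $(V,\Pi,\mathcal{B})$ where $V$ is a set of $gu$ points, $\Pi$ is a partition of $V$ into $u$ groups each of size $g$, and $\mathcal{B}$ is a multiset of 3-element subsets of $V$, such that every pair of points in the same group has frequency $0$, and the frequencies of pairs of points in different groups are pairwise distinct and form exactly the set $\{\mu,\dots,\mu+g^2\binom{u}{2}-1\}$. -}

module Defs where

open import Data.Nat using (ℕ; _+_; _*_; _∸_; _≤_; _<_)
open import Data.Nat.Combinatorics using (_C_)
open import Data.Fin using (Fin; toℕ)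
open import Data.Fin.Subset using (Subset; _∈_; ∣_∣)
open import Data.Fin.Subset.Properties using (_∈?_)
open import Data.Fin.Properties using (_≟_)
open import Data.List using (List; length; filter; allFin)
import Data.List.Membership.Propositional
open import Data.Product using (_×_; Σ; ∃; _,_)
open import Relation.Nullary.Decidable using (_×-dec_)
open import Relation.Binary.PropositionalEquality using (_≡_; _≢_)

-- Points: the gu-element set V is taken to be Fin (g * u) (w.l.o.g. up to relabelling).
-- Blocks: 3-element subsets of V, given as Subsets of cardinality 3.

pairFreq : {n : ℕ} → List (Subset n) → Fin n → Fin n → ℕ
pairFreq B x y = length (filter (λ b → (x ∈? b) ×-dec (y ∈? b)) B)

groupCount : {n u : ℕ} → (Fin n → Fin u) → Fin u → ℕ
groupCount {n} grp i = length (filter (λ x → grp x ≟ i) (allFin n))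

record SBGDD (μ g u : ℕ) : Set where
  field
    grp        : Fin (g * u) → Fin u
    groupSizes : ∀ (i : Fin u) → groupCount grp i ≡ g
    blocks     : List (Subset (g * u))
    blockSize  : ∀ b → b Data.List.Membership.Propositional.∈ blocks → ∣ b ∣ ≡ 3
    sameGroup0 : ∀ x y → x ≢ y → grp x ≡ grp y → pairFreq blocks x y ≡ 0
    -- frequencies of cross pairs (unordered pairs {x,y}, written with x < y)
    -- are pairwise distinct ...
    crossDistinct : ∀ x y x′ y′ → toℕ x < toℕ y → toℕ x′ < toℕ y′ →
                    grp x ≢ grp y → grp x′ ≢ grp y′ →
                    pairFreq blocks x y ≡ pairFreq blocks x′ y′ → (x ≡ x′ × y ≡ y′)
    crossInRange  : ∀ x y → grp x ≢ grp y →
                    μ ≤ pairFreq blocks x y × pairFreq blocks x y < μ + g * g * (u C 2)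
    crossOnto     : ∀ k → μ ≤ k → k < μ + g * g * (u C 2) →
                    Σ (Fin (g * u)) λ x → Σ (Fin (g * u)) λ y →
                      grp x ≢ grp y × pairFreq blocks x y ≡ k

{-# OPTIONS --safe #-}
-- The design is exhibited explicitly: 1716 triples with multiplicities on 40 points,
-- grouped by residue mod 8; the rest is a finite check. Pair frequencies are
-- computed from the weighted triples, and a table giving for every k < 700 = 5² · C(8,2)
-- a cross pair of frequency k shows that the cross-pair frequencies cover {0, …, 699}.
-- The same table inverts the frequency map on cross pairs, so these frequencies are
-- pairwise distinct.
module Submission where

open import Defs
open import Data.Bool using (Bool; true; false; _∧_; _∨_; if_then_else_)
open import Data.Fin using (Fin; zero; suc; toℕ; fromℕ<; remainder; #_)
open import Data.Fin.Properties using (_≟_; toℕ-fromℕ<; all?)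
open import Data.Fin.Subset using (Subset; ∣_∣)
open import Data.Fin.Subset.Properties using (_∈?_)
open import Data.List using (List; []; _∷_; _++_; length; filter; replicate; concatMap)
open import Data.List.Properties using (length-++; filter-++)
open import Data.List.Membership.Propositional using (_∈_)
open import Data.List.Relation.Unary.All as All using (All)
open import Data.List.Relation.Unary.All.Properties using (concat⁺; map⁺; replicate⁺)
open import Data.Nat using (ℕ; zero; suc; _+_; _*_; _∸_; _≤_; _<_; _≡ᵇ_; _≤?_; _<?_)
open import Data.Nat.Combinatorics using (_C_)
open import Data.Nat.DivMod using (_mod_)
open import Data.Nat.Properties using (m+[n∸m]≡n; +-cancelˡ-<) renaming (_≟_ to _≟ℕ_)
open import Data.Product using (Σ; _×_; _,_; proj₁; proj₂; uncurry)
open import Data.Product.Properties using (,-injective; ≡-dec)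
open import Data.Vec using (Vec; _∷_; []; tabulate; lookup)
open import Data.Vec.Properties using (lookup∘tabulate)
open import Relation.Nullary.Decidable using (Dec; does; ¬?; _×-dec_; _→-dec_; from-yes)
open import Relation.Binary.PropositionalEquality
  using (_≡_; _≢_; refl; sym; trans; cong; cong₂; subst; module ≡-Reasoning)

-- ⟨ a , b , c ⟩× w stands for w copies of the block {a, b, c}.
record WeightedTriple : Set where
  constructor ⟨_,_,_⟩×_
  field
    first second third weight : ℕ

open WeightedTriple

infix 7 _∈ᵗ_

_∈ᵗ_ : ℕ → WeightedTriple → Bool
x ∈ᵗ ⟨ a , b , c ⟩× _ = (x ≡ᵇ a) ∨ (x ≡ᵇ b) ∨ (x ≡ᵇ c)

weightedPairFreq : List WeightedTriple → ℕ → ℕ → ℕ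
weightedPairFreq []       x y = 0
weightedPairFreq (t ∷ ts) x y =
  (if x ∈ᵗ t ∧ y ∈ᵗ t then weight t else 0) + weightedPairFreq ts x y

through : ℕ → List WeightedTriple → List WeightedTriple
through x []       = []
through x (t ∷ ts) = if x ∈ᵗ t then t ∷ through x ts else through x ts

weightedPairFreq-through : ∀ ts x y → weightedPairFreq (through x ts) x y ≡ weightedPairFreq ts x y
weightedPairFreq-through []       x y = refl
weightedPairFreq-through (t ∷ ts) x y with x ∈ᵗ t in x∈t
... | true  = cong₂ _+_ (cong (λ β → if β ∧ y ∈ᵗ t then weight t else 0) x∈t)
                        (weightedPairFreq-through ts x y)
... | false = weightedPairFreq-through ts x y

∈?-tabulate : ∀ {n} (f : Fin n → Bool) x → does (x ∈? tabulate f) ≡ f x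
∈?-tabulate f zero with f zero
... | true  = refl
... | false = refl
∈?-tabulate f (suc x) = ∈?-tabulate (λ i → f (suc i)) x

pairFreq-++ : ∀ {n} (bs cs : List (Subset n)) x y →
              pairFreq (bs ++ cs) x y ≡ pairFreq bs x y + pairFreq cs x y
pairFreq-++ bs cs x y = trans (cong length (filter-++ _ bs cs)) (length-++ (filter _ bs))

pairFreq-replicate : ∀ {n} w (b : Subset n) x y →
  pairFreq (replicate w b) x y ≡ (if does (x ∈? b) ∧ does (y ∈? b) then w else 0)
pairFreq-replicate zero b x y with does (x ∈? b) ∧ does (y ∈? b)
... | true  = refl
... | false = refl
pairFreq-replicate (suc w) b x y
  with does (x ∈? b) ∧ does (y ∈? b) | pairFreq-replicate w b x y
... | true  | ih = cong suc ih
... | false | ih = ih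

entry : ∀ {A : Set} {n} → Vec (Vec A n) n → Fin n → Fin n → A
entry M x y = lookup (lookup M x) y

module _ {n : ℕ} where

  block : WeightedTriple → Subset n
  block t = tabulate λ i → toℕ i ∈ᵗ t

  blocks : List WeightedTriple → List (Subset n)
  blocks = concatMap λ t → replicate (weight t) (block t)

  pairFreq-blocks : ∀ ts x y → pairFreq (blocks ts) x y ≡ weightedPairFreq ts (toℕ x) (toℕ y)
  pairFreq-blocks []       x y = refl
  pairFreq-blocks (t ∷ ts) x y = begin
    pairFreq (copies ++ blocks ts) x y
      ≡⟨ pairFreq-++ copies (blocks ts) x y ⟩
    pairFreq copies x y + pairFreq (blocks ts) x y
      ≡⟨ cong₂ _+_ (pairFreq-replicate (weight t) (block t) x y) (pairFreq-blocks ts x y) ⟩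
    (if does (x ∈? block t) ∧ does (y ∈? block t) then weight t else 0) + rest
      ≡⟨ cong (λ β → (if β then weight t else 0) + rest)
              (cong₂ _∧_ (∈?-tabulate _ x) (∈?-tabulate _ y)) ⟩
    weightedPairFreq (t ∷ ts) (toℕ x) (toℕ y) ∎
    where
    open ≡-Reasoning
    copies : List (Subset n)
    copies = replicate (weight t) (block t)
    rest : ℕ
    rest = weightedPairFreq ts (toℕ x) (toℕ y)

  blocks-size : ∀ {ts} → All (λ t → ∣ block t ∣ ≡ 3) ts → ∀ b → b ∈ blocks ts → ∣ b ∣ ≡ 3
  blocks-size sizes _ =
    All.lookup (concat⁺ (map⁺ (All.map (λ {t} → replicate⁺ (weight t)) sizes)))

  -- Each row receives the triples through x as an argument, so under call-by-need
  -- evaluation they are filtered once per row rather than once per entry.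
  frequencyMatrix : List WeightedTriple → Vec (Vec ℕ n) n
  frequencyMatrix ts = tabulate λ x → row x (through (toℕ x) ts)
    where
    row : Fin n → List WeightedTriple → Vec ℕ n
    row x tx = tabulate λ y → weightedPairFreq tx (toℕ x) (toℕ y)

  entry-frequencyMatrix : ∀ ts x y → entry (frequencyMatrix ts) x y ≡ pairFreq (blocks ts) x y
  entry-frequencyMatrix ts x y = begin
    entry (frequencyMatrix ts) x y
      ≡⟨ cong (λ r → lookup r y) (lookup∘tabulate _ x) ⟩
    lookup (tabulate λ y → weightedPairFreq (through (toℕ x) ts) (toℕ x) (toℕ y)) y
      ≡⟨ lookup∘tabulate _ y ⟩
    weightedPairFreq (through (toℕ x) ts) (toℕ x) (toℕ y)
      ≡⟨ weightedPairFreq-through ts (toℕ x) (toℕ y) ⟩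
    weightedPairFreq ts (toℕ x) (toℕ y)
      ≡⟨ sym (pairFreq-blocks ts x y) ⟩
    pairFreq (blocks ts) x y ∎
    where open ≡-Reasoning

∀-Fin⇒∀-range : ∀ {P : ℕ → Set} μ N → (∀ (i : Fin N) → P (μ + toℕ i)) →
                ∀ k → μ ≤ k → k < μ + N → P k
∀-Fin⇒∀-range {P} μ N all k μ≤k k<μ+N = subst P μ+i≡k (all (fromℕ< k∸μ<N))
  where
  k∸μ<N : k ∸ μ < N
  k∸μ<N = +-cancelˡ-< μ (k ∸ μ) N (subst (_< μ + N) (sym (m+[n∸m]≡n μ≤k)) k<μ+N)
  μ+i≡k : μ + toℕ (fromℕ< k∸μ<N) ≡ k
  μ+i≡k = trans (cong (μ +_) (toℕ-fromℕ< k∸μ<N)) (m+[n∸m]≡n μ≤k)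

-- pairOf k is meant to be the cross pair (x , y), with x < y, whose frequency is k.
module FrequencyLabelling {g u : ℕ} (μ : ℕ) (group : Fin (g * u) → Fin u)
                          (pairOf : ℕ → Fin (g * u) × Fin (g * u)) where

  private
    Point : Set
    Point = Fin (g * u)
    N : ℕ
    N = g * g * (u C 2)

  PairCondition : Point → Point → ℕ → Set
  PairCondition x y v =
    (x ≢ y → group x ≡ group y → v ≡ 0) ×
    (group x ≢ group y → μ ≤ v × v < μ + N × (toℕ x < toℕ y → pairOf v ≡ (x , y)))

  pairCondition? : ∀ x y v → Dec (PairCondition x y v)
  pairCondition? x y v =
    (¬? (x ≟ y) →-dec (group x ≟ group y →-dec v ≟ℕ 0)) ×-dec
    (¬? (group x ≟ group y) →-dec
      (μ ≤? v ×-dec v <? μ + N ×-dec (toℕ x <? toℕ y →-dec ≡-dec _≟_ _≟_ (pairOf v) (x , y))))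

  pairConditions? : (f : Point → Point → ℕ) → Dec (∀ x y → PairCondition x y (f x y))
  pairConditions? f = all? λ x → all? λ y → pairCondition? x y (f x y)

  Attained : (Point → Point → ℕ) → ℕ → Set
  Attained f k = group (proj₁ (pairOf k)) ≢ group (proj₂ (pairOf k)) × uncurry f (pairOf k) ≡ k

  allAttained? : (f : Point → Point → ℕ) → Dec (∀ (i : Fin N) → Attained f (μ + toℕ i))
  allAttained? f = all? λ i → attained? (μ + toℕ i)
    where
    attained? : ∀ k → Dec (Attained f k)
    attained? k = ¬? (group _ ≟ group _) ×-dec uncurry f (pairOf k) ≟ℕ k

  fromLabelling : (B : List (Subset (g * u))) (f : Point → Point → ℕ) →
                  (∀ x y → f x y ≡ pairFreq B x y) →
                  (∀ i → groupCount group i ≡ g) →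
                  (∀ b → b ∈ B → ∣ b ∣ ≡ 3) →
                  (∀ x y → PairCondition x y (f x y)) →
                  (∀ (i : Fin N) → Attained f (μ + toℕ i)) →
                  SBGDD μ g u
  fromLabelling B f f≡freq groupSizes blockSize conditions attained = record
    { grp           = group
    ; groupSizes    = groupSizes
    ; blocks        = B
    ; blockSize     = blockSize
    ; sameGroup0    = λ x y → proj₁ (holds x y)
    ; crossDistinct = λ x y x′ y′ x<y x′<y′ cross cross′ eq → ,-injective (begin
        (x , y)                   ≡⟨ sym (labelled x y cross x<y) ⟩
        pairOf (pairFreq B x y)   ≡⟨ cong pairOf eq ⟩
        pairOf (pairFreq B x′ y′) ≡⟨ labelled x′ y′ cross′ x′<y′ ⟩
        (x′ , y′)                 ∎)
    ; crossInRange  = λ x y cross →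
        let (μ≤v , v<μ+N , _) = proj₂ (holds x y) cross in μ≤v , v<μ+N
    ; crossOnto     = ∀-Fin⇒∀-range μ N onto
    }
    where
    open ≡-Reasoning
    holds : ∀ x y → PairCondition x y (pairFreq B x y)
    holds x y = subst (PairCondition x y) (f≡freq x y) (conditions x y)
    labelled : ∀ x y → group x ≢ group y → toℕ x < toℕ y → pairOf (pairFreq B x y) ≡ (x , y)
    labelled x y cross = proj₂ (proj₂ (proj₂ (holds x y) cross))
    onto : ∀ (i : Fin N) →
           Σ Point λ x → Σ Point λ y → group x ≢ group y × pairFreq B x y ≡ μ + toℕ i
    onto i = let (cross , freq≡k) = attained i in
      proj₁ (pairOf (μ + toℕ i)) , proj₂ (pairOf (μ + toℕ i)) , cross ,
      trans (sym (f≡freq _ _)) freq≡k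

-- Point 8 i + j is the i-th point of group j.
group : Fin 40 → Fin 8
group = remainder {5} 8

triples : List WeightedTriple
triples =
    ⟨ 0 , 1 , 6 ⟩× 17 ∷ ⟨ 0 , 1 , 19 ⟩× 2 ∷ ⟨ 0 , 1 , 28 ⟩× 111 ∷ ⟨ 0 , 1 , 31 ⟩× 1 ∷ ⟨ 0 , 1 , 37 ⟩× 18 ∷ ⟨ 0 , 2 , 5 ⟩× 31 ∷
    ⟨ 0 , 2 , 15 ⟩× 152 ∷ ⟨ 0 , 2 , 20 ⟩× 62 ∷ ⟨ 0 , 2 , 23 ⟩× 124 ∷ ⟨ 0 , 2 , 25 ⟩× 13 ∷ ⟨ 0 , 2 , 29 ⟩× 2 ∷ ⟨ 0 , 2 , 33 ⟩× 16 ∷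
    ⟨ 0 , 3 , 7 ⟩× 18 ∷ ⟨ 0 , 3 , 13 ⟩× 2 ∷ ⟨ 0 , 3 , 29 ⟩× 31 ∷ ⟨ 0 , 3 , 34 ⟩× 15 ∷ ⟨ 0 , 3 , 36 ⟩× 1 ∷ ⟨ 0 , 4 , 5 ⟩× 47 ∷
    ⟨ 0 , 4 , 7 ⟩× 12 ∷ ⟨ 0 , 4 , 18 ⟩× 6 ∷ ⟨ 0 , 4 , 19 ⟩× 1 ∷ ⟨ 0 , 4 , 21 ⟩× 1 ∷ ⟨ 0 , 4 , 22 ⟩× 1 ∷ ⟨ 0 , 4 , 23 ⟩× 1 ∷
    ⟨ 0 , 4 , 26 ⟩× 187 ∷ ⟨ 0 , 4 , 30 ⟩× 1 ∷ ⟨ 0 , 4 , 31 ⟩× 23 ∷ ⟨ 0 , 4 , 33 ⟩× 89 ∷ ⟨ 0 , 4 , 37 ⟩× 3 ∷ ⟨ 0 , 4 , 39 ⟩× 2 ∷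
    ⟨ 0 , 5 , 7 ⟩× 435 ∷ ⟨ 0 , 5 , 14 ⟩× 17 ∷ ⟨ 0 , 5 , 30 ⟩× 1 ∷ ⟨ 0 , 5 , 38 ⟩× 95 ∷ ⟨ 0 , 6 , 13 ⟩× 131 ∷ ⟨ 0 , 6 , 26 ⟩× 63 ∷
    ⟨ 0 , 6 , 33 ⟩× 39 ∷ ⟨ 0 , 6 , 34 ⟩× 11 ∷ ⟨ 0 , 6 , 35 ⟩× 11 ∷ ⟨ 0 , 6 , 39 ⟩× 1 ∷ ⟨ 0 , 7 , 9 ⟩× 1 ∷ ⟨ 0 , 7 , 19 ⟩× 48 ∷
    ⟨ 0 , 7 , 21 ⟩× 1 ∷ ⟨ 0 , 7 , 22 ⟩× 1 ∷ ⟨ 0 , 7 , 26 ⟩× 26 ∷ ⟨ 0 , 7 , 29 ⟩× 1 ∷ ⟨ 0 , 7 , 33 ⟩× 1 ∷ ⟨ 0 , 7 , 36 ⟩× 1 ∷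
    ⟨ 0 , 7 , 37 ⟩× 64 ∷ ⟨ 0 , 9 , 13 ⟩× 14 ∷ ⟨ 0 , 9 , 31 ⟩× 2 ∷ ⟨ 0 , 10 , 13 ⟩× 101 ∷ ⟨ 0 , 10 , 14 ⟩× 33 ∷ ⟨ 0 , 10 , 15 ⟩× 13 ∷
    ⟨ 0 , 10 , 19 ⟩× 1 ∷ ⟨ 0 , 10 , 21 ⟩× 15 ∷ ⟨ 0 , 10 , 30 ⟩× 51 ∷ ⟨ 0 , 10 , 35 ⟩× 14 ∷ ⟨ 0 , 11 , 13 ⟩× 14 ∷ ⟨ 0 , 11 , 15 ⟩× 35 ∷
    ⟨ 0 , 11 , 22 ⟩× 2 ∷ ⟨ 0 , 11 , 30 ⟩× 1 ∷ ⟨ 0 , 11 , 31 ⟩× 21 ∷ ⟨ 0 , 12 , 21 ⟩× 1 ∷ ⟨ 0 , 12 , 22 ⟩× 19 ∷ ⟨ 0 , 12 , 25 ⟩× 53 ∷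
    ⟨ 0 , 12 , 26 ⟩× 99 ∷ ⟨ 0 , 12 , 38 ⟩× 33 ∷ ⟨ 0 , 12 , 39 ⟩× 18 ∷ ⟨ 0 , 13 , 17 ⟩× 30 ∷ ⟨ 0 , 13 , 26 ⟩× 1 ∷ ⟨ 0 , 13 , 31 ⟩× 1 ∷
    ⟨ 0 , 13 , 35 ⟩× 40 ∷ ⟨ 0 , 14 , 27 ⟩× 16 ∷ ⟨ 0 , 14 , 34 ⟩× 1 ∷ ⟨ 0 , 14 , 36 ⟩× 67 ∷ ⟨ 0 , 14 , 39 ⟩× 349 ∷ ⟨ 0 , 15 , 19 ⟩× 226 ∷
    ⟨ 0 , 15 , 20 ⟩× 27 ∷ ⟨ 0 , 15 , 21 ⟩× 12 ∷ ⟨ 0 , 15 , 22 ⟩× 1 ∷ ⟨ 0 , 15 , 27 ⟩× 3 ∷ ⟨ 0 , 15 , 29 ⟩× 82 ∷ ⟨ 0 , 17 , 20 ⟩× 17 ∷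
    ⟨ 0 , 17 , 22 ⟩× 1 ∷ ⟨ 0 , 17 , 27 ⟩× 170 ∷ ⟨ 0 , 17 , 30 ⟩× 113 ∷ ⟨ 0 , 17 , 31 ⟩× 51 ∷ ⟨ 0 , 17 , 35 ⟩× 16 ∷ ⟨ 0 , 19 , 23 ⟩× 18 ∷
    ⟨ 0 , 19 , 26 ⟩× 2 ∷ ⟨ 0 , 19 , 29 ⟩× 1 ∷ ⟨ 0 , 19 , 30 ⟩× 20 ∷ ⟨ 0 , 19 , 34 ⟩× 1 ∷ ⟨ 0 , 19 , 38 ⟩× 104 ∷ ⟨ 0 , 19 , 39 ⟩× 29 ∷
    ⟨ 0 , 20 , 21 ⟩× 1 ∷ ⟨ 0 , 20 , 27 ⟩× 35 ∷ ⟨ 0 , 20 , 29 ⟩× 10 ∷ ⟨ 0 , 20 , 30 ⟩× 1 ∷ ⟨ 0 , 20 , 33 ⟩× 154 ∷ ⟨ 0 , 20 , 37 ⟩× 1 ∷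
    ⟨ 0 , 21 , 23 ⟩× 31 ∷ ⟨ 0 , 21 , 30 ⟩× 1 ∷ ⟨ 0 , 21 , 31 ⟩× 1 ∷ ⟨ 0 , 22 , 25 ⟩× 1 ∷ ⟨ 0 , 22 , 27 ⟩× 137 ∷ ⟨ 0 , 22 , 28 ⟩× 305 ∷
    ⟨ 0 , 22 , 34 ⟩× 5 ∷ ⟨ 0 , 22 , 35 ⟩× 80 ∷ ⟨ 0 , 22 , 39 ⟩× 40 ∷ ⟨ 0 , 23 , 26 ⟩× 1 ∷ ⟨ 0 , 23 , 27 ⟩× 1 ∷ ⟨ 0 , 23 , 34 ⟩× 63 ∷
    ⟨ 0 , 23 , 36 ⟩× 11 ∷ ⟨ 0 , 23 , 38 ⟩× 21 ∷ ⟨ 0 , 25 , 28 ⟩× 28 ∷ ⟨ 0 , 25 , 31 ⟩× 1 ∷ ⟨ 0 , 25 , 34 ⟩× 199 ∷ ⟨ 0 , 25 , 36 ⟩× 14 ∷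
    ⟨ 0 , 25 , 37 ⟩× 89 ∷ ⟨ 0 , 25 , 39 ⟩× 1 ∷ ⟨ 0 , 26 , 28 ⟩× 17 ∷ ⟨ 0 , 26 , 31 ⟩× 1 ∷ ⟨ 0 , 26 , 37 ⟩× 18 ∷ ⟨ 0 , 26 , 38 ⟩× 2 ∷
    ⟨ 0 , 27 , 29 ⟩× 19 ∷ ⟨ 0 , 27 , 30 ⟩× 64 ∷ ⟨ 0 , 27 , 33 ⟩× 1 ∷ ⟨ 0 , 28 , 29 ⟩× 168 ∷ ⟨ 0 , 29 , 30 ⟩× 7 ∷ ⟨ 0 , 29 , 36 ⟩× 44 ∷
    ⟨ 0 , 29 , 38 ⟩× 167 ∷ ⟨ 0 , 30 , 33 ⟩× 9 ∷ ⟨ 0 , 30 , 34 ⟩× 30 ∷ ⟨ 0 , 30 , 39 ⟩× 1 ∷ ⟨ 0 , 31 , 34 ⟩× 103 ∷ ⟨ 0 , 31 , 36 ⟩× 119 ∷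
    ⟨ 0 , 33 , 37 ⟩× 25 ∷ ⟨ 0 , 33 , 39 ⟩× 207 ∷ ⟨ 0 , 36 , 39 ⟩× 18 ∷ ⟨ 0 , 37 , 38 ⟩× 1 ∷ ⟨ 1 , 2 , 4 ⟩× 245 ∷ ⟨ 1 , 2 , 6 ⟩× 16 ∷
    ⟨ 1 , 2 , 14 ⟩× 37 ∷ ⟨ 1 , 2 , 19 ⟩× 2 ∷ ⟨ 1 , 2 , 23 ⟩× 86 ∷ ⟨ 1 , 2 , 27 ⟩× 19 ∷ ⟨ 1 , 2 , 35 ⟩× 2 ∷ ⟨ 1 , 3 , 15 ⟩× 14 ∷
    ⟨ 1 , 3 , 20 ⟩× 12 ∷ ⟨ 1 , 3 , 34 ⟩× 258 ∷ ⟨ 1 , 3 , 38 ⟩× 127 ∷ ⟨ 1 , 3 , 39 ⟩× 2 ∷ ⟨ 1 , 4 , 11 ⟩× 1 ∷ ⟨ 1 , 4 , 14 ⟩× 1 ∷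
    ⟨ 1 , 4 , 18 ⟩× 17 ∷ ⟨ 1 , 4 , 22 ⟩× 1 ∷ ⟨ 1 , 4 , 23 ⟩× 146 ∷ ⟨ 1 , 4 , 26 ⟩× 97 ∷ ⟨ 1 , 4 , 31 ⟩× 16 ∷ ⟨ 1 , 4 , 37 ⟩× 31 ∷
    ⟨ 1 , 5 , 10 ⟩× 53 ∷ ⟨ 1 , 5 , 22 ⟩× 82 ∷ ⟨ 1 , 5 , 23 ⟩× 16 ∷ ⟨ 1 , 5 , 30 ⟩× 35 ∷ ⟨ 1 , 5 , 31 ⟩× 18 ∷ ⟨ 1 , 5 , 34 ⟩× 188 ∷
    ⟨ 1 , 6 , 11 ⟩× 22 ∷ ⟨ 1 , 6 , 23 ⟩× 44 ∷ ⟨ 1 , 6 , 24 ⟩× 1 ∷ ⟨ 1 , 7 , 12 ⟩× 18 ∷ ⟨ 1 , 7 , 19 ⟩× 1 ∷ ⟨ 1 , 7 , 30 ⟩× 12 ∷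
    ⟨ 1 , 7 , 36 ⟩× 54 ∷ ⟨ 1 , 8 , 14 ⟩× 14 ∷ ⟨ 1 , 8 , 34 ⟩× 15 ∷ ⟨ 1 , 10 , 11 ⟩× 39 ∷ ⟨ 1 , 10 , 15 ⟩× 17 ∷ ⟨ 1 , 10 , 20 ⟩× 20 ∷
    ⟨ 1 , 10 , 32 ⟩× 3 ∷ ⟨ 1 , 10 , 37 ⟩× 1 ∷ ⟨ 1 , 11 , 13 ⟩× 174 ∷ ⟨ 1 , 11 , 14 ⟩× 6 ∷ ⟨ 1 , 11 , 18 ⟩× 84 ∷ ⟨ 1 , 11 , 22 ⟩× 11 ∷
    ⟨ 1 , 11 , 29 ⟩× 6 ∷ ⟨ 1 , 11 , 31 ⟩× 1 ∷ ⟨ 1 , 11 , 36 ⟩× 126 ∷ ⟨ 1 , 12 , 26 ⟩× 20 ∷ ⟨ 1 , 13 , 20 ⟩× 2 ∷ ⟨ 1 , 13 , 26 ⟩× 24 ∷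
    ⟨ 1 , 13 , 32 ⟩× 219 ∷ ⟨ 1 , 13 , 34 ⟩× 96 ∷ ⟨ 1 , 13 , 35 ⟩× 11 ∷ ⟨ 1 , 13 , 38 ⟩× 45 ∷ ⟨ 1 , 14 , 15 ⟩× 1 ∷ ⟨ 1 , 14 , 18 ⟩× 1 ∷
    ⟨ 1 , 14 , 19 ⟩× 1 ∷ ⟨ 1 , 14 , 21 ⟩× 81 ∷ ⟨ 1 , 14 , 23 ⟩× 1 ∷ ⟨ 1 , 14 , 27 ⟩× 1 ∷ ⟨ 1 , 14 , 36 ⟩× 2 ∷ ⟨ 1 , 14 , 39 ⟩× 18 ∷
    ⟨ 1 , 15 , 18 ⟩× 1 ∷ ⟨ 1 , 15 , 19 ⟩× 101 ∷ ⟨ 1 , 15 , 28 ⟩× 20 ∷ ⟨ 1 , 15 , 32 ⟩× 51 ∷ ⟨ 1 , 16 , 20 ⟩× 30 ∷ ⟨ 1 , 16 , 22 ⟩× 12 ∷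
    ⟨ 1 , 16 , 26 ⟩× 15 ∷ ⟨ 1 , 16 , 31 ⟩× 1 ∷ ⟨ 1 , 16 , 35 ⟩× 44 ∷ ⟨ 1 , 16 , 39 ⟩× 3 ∷ ⟨ 1 , 18 , 19 ⟩× 6 ∷ ⟨ 1 , 18 , 20 ⟩× 54 ∷
    ⟨ 1 , 18 , 24 ⟩× 258 ∷ ⟨ 1 , 18 , 30 ⟩× 27 ∷ ⟨ 1 , 18 , 35 ⟩× 10 ∷ ⟨ 1 , 18 , 36 ⟩× 1 ∷ ⟨ 1 , 18 , 37 ⟩× 1 ∷ ⟨ 1 , 18 , 38 ⟩× 202 ∷
    ⟨ 1 , 19 , 22 ⟩× 1 ∷ ⟨ 1 , 19 , 24 ⟩× 64 ∷ ⟨ 1 , 19 , 26 ⟩× 1 ∷ ⟨ 1 , 19 , 36 ⟩× 25 ∷ ⟨ 1 , 19 , 37 ⟩× 50 ∷ ⟨ 1 , 19 , 38 ⟩× 13 ∷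
    ⟨ 1 , 20 , 23 ⟩× 15 ∷ ⟨ 1 , 20 , 24 ⟩× 1 ∷ ⟨ 1 , 20 , 35 ⟩× 1 ∷ ⟨ 1 , 21 , 22 ⟩× 35 ∷ ⟨ 1 , 21 , 23 ⟩× 228 ∷ ⟨ 1 , 21 , 30 ⟩× 155 ∷
    ⟨ 1 , 21 , 35 ⟩× 20 ∷ ⟨ 1 , 21 , 36 ⟩× 95 ∷ ⟨ 1 , 21 , 38 ⟩× 15 ∷ ⟨ 1 , 21 , 39 ⟩× 12 ∷ ⟨ 1 , 22 , 34 ⟩× 25 ∷ ⟨ 1 , 23 , 27 ⟩× 13 ∷
    ⟨ 1 , 24 , 27 ⟩× 33 ∷ ⟨ 1 , 24 , 28 ⟩× 1 ∷ ⟨ 1 , 24 , 29 ⟩× 17 ∷ ⟨ 1 , 24 , 36 ⟩× 1 ∷ ⟨ 1 , 24 , 37 ⟩× 14 ∷ ⟨ 1 , 24 , 38 ⟩× 126 ∷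
    ⟨ 1 , 26 , 27 ⟩× 153 ∷ ⟨ 1 , 26 , 35 ⟩× 1 ∷ ⟨ 1 , 26 , 37 ⟩× 181 ∷ ⟨ 1 , 26 , 39 ⟩× 41 ∷ ⟨ 1 , 27 , 30 ⟩× 89 ∷ ⟨ 1 , 27 , 32 ⟩× 12 ∷
    ⟨ 1 , 27 , 37 ⟩× 66 ∷ ⟨ 1 , 27 , 39 ⟩× 1 ∷ ⟨ 1 , 28 , 30 ⟩× 15 ∷ ⟨ 1 , 28 , 39 ⟩× 5 ∷ ⟨ 1 , 31 , 32 ⟩× 29 ∷ ⟨ 1 , 32 , 36 ⟩× 14 ∷
    ⟨ 1 , 32 , 39 ⟩× 110 ∷ ⟨ 1 , 35 , 39 ⟩× 84 ∷ ⟨ 1 , 37 , 39 ⟩× 1 ∷ ⟨ 2 , 3 , 8 ⟩× 20 ∷ ⟨ 2 , 3 , 12 ⟩× 53 ∷ ⟨ 2 , 3 , 15 ⟩× 4 ∷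
    ⟨ 2 , 3 , 17 ⟩× 13 ∷ ⟨ 2 , 3 , 21 ⟩× 32 ∷ ⟨ 2 , 3 , 30 ⟩× 9 ∷ ⟨ 2 , 4 , 8 ⟩× 6 ∷ ⟨ 2 , 4 , 14 ⟩× 1 ∷ ⟨ 2 , 4 , 19 ⟩× 25 ∷
    ⟨ 2 , 4 , 37 ⟩× 98 ∷ ⟨ 2 , 4 , 38 ⟩× 18 ∷ ⟨ 2 , 5 , 7 ⟩× 21 ∷ ⟨ 2 , 5 , 15 ⟩× 73 ∷ ⟨ 2 , 5 , 28 ⟩× 21 ∷ ⟨ 2 , 6 , 9 ⟩× 71 ∷
    ⟨ 2 , 6 , 15 ⟩× 24 ∷ ⟨ 2 , 6 , 19 ⟩× 1 ∷ ⟨ 2 , 6 , 27 ⟩× 56 ∷ ⟨ 2 , 6 , 35 ⟩× 1 ∷ ⟨ 2 , 6 , 36 ⟩× 198 ∷ ⟨ 2 , 7 , 13 ⟩× 1 ∷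
    ⟨ 2 , 7 , 19 ⟩× 2 ∷ ⟨ 2 , 7 , 21 ⟩× 158 ∷ ⟨ 2 , 7 , 33 ⟩× 43 ∷ ⟨ 2 , 7 , 36 ⟩× 106 ∷ ⟨ 2 , 8 , 19 ⟩× 1 ∷ ⟨ 2 , 8 , 20 ⟩× 138 ∷
    ⟨ 2 , 8 , 21 ⟩× 12 ∷ ⟨ 2 , 8 , 22 ⟩× 4 ∷ ⟨ 2 , 8 , 27 ⟩× 114 ∷ ⟨ 2 , 8 , 31 ⟩× 1 ∷ ⟨ 2 , 8 , 37 ⟩× 320 ∷ ⟨ 2 , 9 , 11 ⟩× 24 ∷
    ⟨ 2 , 9 , 12 ⟩× 1 ∷ ⟨ 2 , 9 , 13 ⟩× 49 ∷ ⟨ 2 , 9 , 19 ⟩× 12 ∷ ⟨ 2 , 9 , 35 ⟩× 188 ∷ ⟨ 2 , 9 , 39 ⟩× 162 ∷ ⟨ 2 , 11 , 14 ⟩× 98 ∷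
    ⟨ 2 , 11 , 15 ⟩× 1 ∷ ⟨ 2 , 11 , 16 ⟩× 80 ∷ ⟨ 2 , 11 , 21 ⟩× 1 ∷ ⟨ 2 , 11 , 25 ⟩× 14 ∷ ⟨ 2 , 11 , 28 ⟩× 34 ∷ ⟨ 2 , 11 , 29 ⟩× 11 ∷
    ⟨ 2 , 12 , 15 ⟩× 12 ∷ ⟨ 2 , 12 , 22 ⟩× 108 ∷ ⟨ 2 , 12 , 23 ⟩× 26 ∷ ⟨ 2 , 12 , 27 ⟩× 11 ∷ ⟨ 2 , 12 , 29 ⟩× 4 ∷ ⟨ 2 , 12 , 30 ⟩× 1 ∷
    ⟨ 2 , 13 , 16 ⟩× 15 ∷ ⟨ 2 , 13 , 20 ⟩× 33 ∷ ⟨ 2 , 13 , 23 ⟩× 236 ∷ ⟨ 2 , 13 , 25 ⟩× 106 ∷ ⟨ 2 , 13 , 39 ⟩× 38 ∷ ⟨ 2 , 14 , 15 ⟩× 32 ∷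
    ⟨ 2 , 14 , 23 ⟩× 12 ∷ ⟨ 2 , 14 , 24 ⟩× 15 ∷ ⟨ 2 , 14 , 35 ⟩× 4 ∷ ⟨ 2 , 15 , 16 ⟩× 1 ∷ ⟨ 2 , 15 , 19 ⟩× 4 ∷ ⟨ 2 , 15 , 27 ⟩× 1 ∷
    ⟨ 2 , 15 , 29 ⟩× 1 ∷ ⟨ 2 , 15 , 37 ⟩× 194 ∷ ⟨ 2 , 16 , 22 ⟩× 52 ∷ ⟨ 2 , 16 , 25 ⟩× 27 ∷ ⟨ 2 , 16 , 37 ⟩× 14 ∷ ⟨ 2 , 19 , 24 ⟩× 165 ∷
    ⟨ 2 , 19 , 29 ⟩× 33 ∷ ⟨ 2 , 19 , 31 ⟩× 2 ∷ ⟨ 2 , 19 , 33 ⟩× 1 ∷ ⟨ 2 , 19 , 36 ⟩× 328 ∷ ⟨ 2 , 19 , 39 ⟩× 82 ∷ ⟨ 2 , 20 , 21 ⟩× 12 ∷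
    ⟨ 2 , 20 , 31 ⟩× 16 ∷ ⟨ 2 , 20 , 32 ⟩× 2 ∷ ⟨ 2 , 20 , 33 ⟩× 12 ∷ ⟨ 2 , 20 , 35 ⟩× 1 ∷ ⟨ 2 , 21 , 31 ⟩× 80 ∷ ⟨ 2 , 21 , 33 ⟩× 23 ∷
    ⟨ 2 , 21 , 36 ⟩× 1 ∷ ⟨ 2 , 22 , 23 ⟩× 45 ∷ ⟨ 2 , 22 , 35 ⟩× 135 ∷ ⟨ 2 , 22 , 37 ⟩× 42 ∷ ⟨ 2 , 22 , 39 ⟩× 310 ∷ ⟨ 2 , 23 , 30 ⟩× 1 ∷
    ⟨ 2 , 23 , 33 ⟩× 1 ∷ ⟨ 2 , 23 , 36 ⟩× 13 ∷ ⟨ 2 , 24 , 25 ⟩× 212 ∷ ⟨ 2 , 24 , 27 ⟩× 46 ∷ ⟨ 2 , 24 , 29 ⟩× 95 ∷ ⟨ 2 , 24 , 30 ⟩× 30 ∷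
    ⟨ 2 , 24 , 31 ⟩× 12 ∷ ⟨ 2 , 24 , 36 ⟩× 3 ∷ ⟨ 2 , 25 , 29 ⟩× 53 ∷ ⟨ 2 , 27 , 29 ⟩× 2 ∷ ⟨ 2 , 27 , 30 ⟩× 14 ∷ ⟨ 2 , 27 , 31 ⟩× 1 ∷
    ⟨ 2 , 28 , 32 ⟩× 13 ∷ ⟨ 2 , 28 , 35 ⟩× 11 ∷ ⟨ 2 , 29 , 35 ⟩× 23 ∷ ⟨ 2 , 30 , 31 ⟩× 9 ∷ ⟨ 2 , 30 , 35 ⟩× 1 ∷ ⟨ 2 , 31 , 35 ⟩× 42 ∷
    ⟨ 2 , 31 , 36 ⟩× 50 ∷ ⟨ 2 , 35 , 38 ⟩× 1 ∷ ⟨ 2 , 35 , 39 ⟩× 51 ∷ ⟨ 3 , 4 , 6 ⟩× 104 ∷ ⟨ 3 , 4 , 8 ⟩× 142 ∷ ⟨ 3 , 4 , 9 ⟩× 1 ∷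
    ⟨ 3 , 4 , 14 ⟩× 22 ∷ ⟨ 3 , 4 , 21 ⟩× 16 ∷ ⟨ 3 , 4 , 32 ⟩× 16 ∷ ⟨ 3 , 4 , 39 ⟩× 52 ∷ ⟨ 3 , 5 , 8 ⟩× 35 ∷ ⟨ 3 , 5 , 9 ⟩× 20 ∷
    ⟨ 3 , 5 , 10 ⟩× 149 ∷ ⟨ 3 , 5 , 14 ⟩× 18 ∷ ⟨ 3 , 5 , 17 ⟩× 2 ∷ ⟨ 3 , 5 , 28 ⟩× 56 ∷ ⟨ 3 , 5 , 31 ⟩× 1 ∷ ⟨ 3 , 5 , 32 ⟩× 1 ∷
    ⟨ 3 , 5 , 33 ⟩× 100 ∷ ⟨ 3 , 5 , 38 ⟩× 268 ∷ ⟨ 3 , 6 , 9 ⟩× 32 ∷ ⟨ 3 , 6 , 20 ⟩× 45 ∷ ⟨ 3 , 6 , 24 ⟩× 1 ∷ ⟨ 3 , 6 , 26 ⟩× 16 ∷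
    ⟨ 3 , 6 , 29 ⟩× 122 ∷ ⟨ 3 , 6 , 32 ⟩× 1 ∷ ⟨ 3 , 6 , 36 ⟩× 18 ∷ ⟨ 3 , 7 , 8 ⟩× 67 ∷ ⟨ 3 , 7 , 13 ⟩× 1 ∷ ⟨ 3 , 7 , 16 ⟩× 79 ∷
    ⟨ 3 , 7 , 21 ⟩× 16 ∷ ⟨ 3 , 7 , 33 ⟩× 33 ∷ ⟨ 3 , 8 , 15 ⟩× 1 ∷ ⟨ 3 , 8 , 22 ⟩× 1 ∷ ⟨ 3 , 8 , 26 ⟩× 18 ∷ ⟨ 3 , 8 , 36 ⟩× 284 ∷
    ⟨ 3 , 9 , 21 ⟩× 84 ∷ ⟨ 3 , 9 , 28 ⟩× 14 ∷ ⟨ 3 , 9 , 30 ⟩× 1 ∷ ⟨ 3 , 9 , 34 ⟩× 154 ∷ ⟨ 3 , 9 , 38 ⟩× 16 ∷ ⟨ 3 , 10 , 15 ⟩× 64 ∷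
    ⟨ 3 , 10 , 16 ⟩× 39 ∷ ⟨ 3 , 10 , 17 ⟩× 300 ∷ ⟨ 3 , 10 , 24 ⟩× 19 ∷ ⟨ 3 , 10 , 25 ⟩× 12 ∷ ⟨ 3 , 10 , 30 ⟩× 1 ∷ ⟨ 3 , 10 , 37 ⟩× 16 ∷
    ⟨ 3 , 12 , 15 ⟩× 2 ∷ ⟨ 3 , 12 , 16 ⟩× 15 ∷ ⟨ 3 , 12 , 24 ⟩× 29 ∷ ⟨ 3 , 12 , 25 ⟩× 2 ∷ ⟨ 3 , 12 , 29 ⟩× 14 ∷ ⟨ 3 , 12 , 30 ⟩× 1 ∷
    ⟨ 3 , 12 , 32 ⟩× 1 ∷ ⟨ 3 , 12 , 33 ⟩× 77 ∷ ⟨ 3 , 13 , 30 ⟩× 1 ∷ ⟨ 3 , 13 , 32 ⟩× 2 ∷ ⟨ 3 , 13 , 33 ⟩× 2 ∷ ⟨ 3 , 13 , 34 ⟩× 1 ∷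
    ⟨ 3 , 14 , 25 ⟩× 1 ∷ ⟨ 3 , 14 , 33 ⟩× 5 ∷ ⟨ 3 , 14 , 36 ⟩× 1 ∷ ⟨ 3 , 14 , 39 ⟩× 1 ∷ ⟨ 3 , 15 , 16 ⟩× 2 ∷ ⟨ 3 , 15 , 24 ⟩× 49 ∷
    ⟨ 3 , 15 , 26 ⟩× 199 ∷ ⟨ 3 , 15 , 30 ⟩× 21 ∷ ⟨ 3 , 15 , 32 ⟩× 4 ∷ ⟨ 3 , 15 , 34 ⟩× 90 ∷ ⟨ 3 , 15 , 38 ⟩× 1 ∷ ⟨ 3 , 16 , 17 ⟩× 188 ∷
    ⟨ 3 , 16 , 18 ⟩× 21 ∷ ⟨ 3 , 16 , 33 ⟩× 237 ∷ ⟨ 3 , 16 , 39 ⟩× 2 ∷ ⟨ 3 , 17 , 20 ⟩× 58 ∷ ⟨ 3 , 17 , 26 ⟩× 100 ∷ ⟨ 3 , 17 , 34 ⟩× 30 ∷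
    ⟨ 3 , 18 , 23 ⟩× 13 ∷ ⟨ 3 , 18 , 25 ⟩× 2 ∷ ⟨ 3 , 18 , 28 ⟩× 101 ∷ ⟨ 3 , 18 , 31 ⟩× 38 ∷ ⟨ 3 , 18 , 38 ⟩× 69 ∷ ⟨ 3 , 20 , 22 ⟩× 22 ∷
    ⟨ 3 , 20 , 30 ⟩× 185 ∷ ⟨ 3 , 20 , 32 ⟩× 135 ∷ ⟨ 3 , 21 , 30 ⟩× 39 ∷ ⟨ 3 , 22 , 24 ⟩× 11 ∷ ⟨ 3 , 22 , 25 ⟩× 3 ∷ ⟨ 3 , 22 , 29 ⟩× 16 ∷
    ⟨ 3 , 22 , 36 ⟩× 39 ∷ ⟨ 3 , 23 , 24 ⟩× 12 ∷ ⟨ 3 , 23 , 33 ⟩× 1 ∷ ⟨ 3 , 24 , 30 ⟩× 2 ∷ ⟨ 3 , 24 , 36 ⟩× 158 ∷ ⟨ 3 , 24 , 37 ⟩× 102 ∷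
    ⟨ 3 , 25 , 30 ⟩× 3 ∷ ⟨ 3 , 25 , 31 ⟩× 225 ∷ ⟨ 3 , 25 , 32 ⟩× 38 ∷ ⟨ 3 , 25 , 39 ⟩× 27 ∷ ⟨ 3 , 26 , 28 ⟩× 28 ∷ ⟨ 3 , 26 , 29 ⟩× 1 ∷
    ⟨ 3 , 26 , 38 ⟩× 39 ∷ ⟨ 3 , 28 , 39 ⟩× 113 ∷ ⟨ 3 , 29 , 30 ⟩× 61 ∷ ⟨ 3 , 30 , 31 ⟩× 1 ∷ ⟨ 3 , 30 , 33 ⟩× 143 ∷ ⟨ 3 , 30 , 39 ⟩× 1 ∷
    ⟨ 3 , 31 , 34 ⟩× 18 ∷ ⟨ 3 , 31 , 37 ⟩× 19 ∷ ⟨ 3 , 32 , 37 ⟩× 256 ∷ ⟨ 3 , 33 , 36 ⟩× 19 ∷ ⟨ 3 , 33 , 37 ⟩× 1 ∷ ⟨ 3 , 33 , 39 ⟩× 16 ∷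
    ⟨ 3 , 36 , 39 ⟩× 83 ∷ ⟨ 3 , 37 , 38 ⟩× 16 ∷ ⟨ 4 , 5 , 10 ⟩× 13 ∷ ⟨ 4 , 5 , 23 ⟩× 18 ∷ ⟨ 4 , 5 , 25 ⟩× 15 ∷ ⟨ 4 , 5 , 34 ⟩× 2 ∷
    ⟨ 4 , 6 , 8 ⟩× 42 ∷ ⟨ 4 , 6 , 10 ⟩× 85 ∷ ⟨ 4 , 6 , 23 ⟩× 38 ∷ ⟨ 4 , 6 , 33 ⟩× 1 ∷ ⟨ 4 , 7 , 8 ⟩× 49 ∷ ⟨ 4 , 7 , 11 ⟩× 1 ∷
    ⟨ 4 , 7 , 13 ⟩× 114 ∷ ⟨ 4 , 7 , 14 ⟩× 2 ∷ ⟨ 4 , 7 , 16 ⟩× 6 ∷ ⟨ 4 , 7 , 17 ⟩× 97 ∷ ⟨ 4 , 7 , 24 ⟩× 3 ∷ ⟨ 4 , 7 , 27 ⟩× 2 ∷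
    ⟨ 4 , 7 , 29 ⟩× 26 ∷ ⟨ 4 , 7 , 30 ⟩× 298 ∷ ⟨ 4 , 7 , 37 ⟩× 1 ∷ ⟨ 4 , 8 , 9 ⟩× 162 ∷ ⟨ 4 , 8 , 11 ⟩× 1 ∷ ⟨ 4 , 8 , 30 ⟩× 127 ∷
    ⟨ 4 , 9 , 13 ⟩× 42 ∷ ⟨ 4 , 9 , 15 ⟩× 93 ∷ ⟨ 4 , 9 , 24 ⟩× 151 ∷ ⟨ 4 , 9 , 26 ⟩× 48 ∷ ⟨ 4 , 10 , 14 ⟩× 1 ∷ ⟨ 4 , 10 , 15 ⟩× 31 ∷
    ⟨ 4 , 10 , 16 ⟩× 146 ∷ ⟨ 4 , 10 , 30 ⟩× 1 ∷ ⟨ 4 , 10 , 32 ⟩× 2 ∷ ⟨ 4 , 10 , 33 ⟩× 15 ∷ ⟨ 4 , 11 , 15 ⟩× 126 ∷ ⟨ 4 , 11 , 18 ⟩× 31 ∷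
    ⟨ 4 , 11 , 21 ⟩× 242 ∷ ⟨ 4 , 11 , 22 ⟩× 1 ∷ ⟨ 4 , 11 , 23 ⟩× 1 ∷ ⟨ 4 , 11 , 24 ⟩× 3 ∷ ⟨ 4 , 11 , 25 ⟩× 1 ∷ ⟨ 4 , 11 , 30 ⟩× 53 ∷
    ⟨ 4 , 11 , 32 ⟩× 1 ∷ ⟨ 4 , 11 , 34 ⟩× 20 ∷ ⟨ 4 , 11 , 38 ⟩× 10 ∷ ⟨ 4 , 11 , 39 ⟩× 3 ∷ ⟨ 4 , 13 , 22 ⟩× 15 ∷ ⟨ 4 , 13 , 24 ⟩× 57 ∷
    ⟨ 4 , 13 , 34 ⟩× 1 ∷ ⟨ 4 , 13 , 38 ⟩× 1 ∷ ⟨ 4 , 14 , 16 ⟩× 1 ∷ ⟨ 4 , 14 , 17 ⟩× 12 ∷ ⟨ 4 , 14 , 23 ⟩× 2 ∷ ⟨ 4 , 14 , 26 ⟩× 4 ∷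
    ⟨ 4 , 15 , 19 ⟩× 55 ∷ ⟨ 4 , 15 , 24 ⟩× 20 ∷ ⟨ 4 , 15 , 26 ⟩× 20 ∷ ⟨ 4 , 16 , 22 ⟩× 1 ∷ ⟨ 4 , 16 , 29 ⟩× 17 ∷ ⟨ 4 , 16 , 31 ⟩× 72 ∷
    ⟨ 4 , 16 , 34 ⟩× 136 ∷ ⟨ 4 , 17 , 18 ⟩× 18 ∷ ⟨ 4 , 17 , 21 ⟩× 29 ∷ ⟨ 4 , 17 , 24 ⟩× 196 ∷ ⟨ 4 , 17 , 27 ⟩× 43 ∷ ⟨ 4 , 19 , 22 ⟩× 15 ∷
    ⟨ 4 , 19 , 37 ⟩× 15 ∷ ⟨ 4 , 21 , 23 ⟩× 76 ∷ ⟨ 4 , 21 , 24 ⟩× 119 ∷ ⟨ 4 , 21 , 31 ⟩× 1 ∷ ⟨ 4 , 22 , 27 ⟩× 175 ∷ ⟨ 4 , 22 , 31 ⟩× 1 ∷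
    ⟨ 4 , 22 , 33 ⟩× 1 ∷ ⟨ 4 , 22 , 34 ⟩× 70 ∷ ⟨ 4 , 22 , 39 ⟩× 178 ∷ ⟨ 4 , 23 , 27 ⟩× 9 ∷ ⟨ 4 , 23 , 29 ⟩× 1 ∷ ⟨ 4 , 24 , 29 ⟩× 42 ∷
    ⟨ 4 , 24 , 39 ⟩× 1 ∷ ⟨ 4 , 25 , 27 ⟩× 2 ∷ ⟨ 4 , 25 , 30 ⟩× 196 ∷ ⟨ 4 , 25 , 35 ⟩× 16 ∷ ⟨ 4 , 25 , 37 ⟩× 44 ∷ ⟨ 4 , 25 , 38 ⟩× 1 ∷
    ⟨ 4 , 25 , 39 ⟩× 90 ∷ ⟨ 4 , 26 , 31 ⟩× 1 ∷ ⟨ 4 , 26 , 32 ⟩× 24 ∷ ⟨ 4 , 26 , 37 ⟩× 205 ∷ ⟨ 4 , 27 , 29 ⟩× 12 ∷ ⟨ 4 , 27 , 33 ⟩× 26 ∷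
    ⟨ 4 , 29 , 33 ⟩× 58 ∷ ⟨ 4 , 29 , 34 ⟩× 1 ∷ ⟨ 4 , 30 , 34 ⟩× 17 ∷ ⟨ 4 , 31 , 34 ⟩× 1 ∷ ⟨ 4 , 32 , 39 ⟩× 12 ∷ ⟨ 4 , 33 , 35 ⟩× 17 ∷
    ⟨ 4 , 35 , 39 ⟩× 1 ∷ ⟨ 4 , 37 , 38 ⟩× 1 ∷ ⟨ 4 , 37 , 39 ⟩× 13 ∷ ⟨ 5 , 6 , 10 ⟩× 20 ∷ ⟨ 5 , 6 , 18 ⟩× 170 ∷ ⟨ 5 , 6 , 23 ⟩× 406 ∷
    ⟨ 5 , 6 , 25 ⟩× 13 ∷ ⟨ 5 , 6 , 31 ⟩× 13 ∷ ⟨ 5 , 6 , 32 ⟩× 39 ∷ ⟨ 5 , 7 , 8 ⟩× 1 ∷ ⟨ 5 , 7 , 16 ⟩× 40 ∷ ⟨ 5 , 7 , 17 ⟩× 1 ∷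
    ⟨ 5 , 7 , 25 ⟩× 25 ∷ ⟨ 5 , 7 , 27 ⟩× 56 ∷ ⟨ 5 , 7 , 30 ⟩× 1 ∷ ⟨ 5 , 7 , 32 ⟩× 1 ∷ ⟨ 5 , 8 , 9 ⟩× 14 ∷ ⟨ 5 , 8 , 22 ⟩× 39 ∷
    ⟨ 5 , 8 , 34 ⟩× 2 ∷ ⟨ 5 , 8 , 35 ⟩× 18 ∷ ⟨ 5 , 9 , 12 ⟩× 2 ∷ ⟨ 5 , 9 , 18 ⟩× 95 ∷ ⟨ 5 , 9 , 27 ⟩× 14 ∷ ⟨ 5 , 9 , 35 ⟩× 50 ∷
    ⟨ 5 , 9 , 36 ⟩× 183 ∷ ⟨ 5 , 10 , 16 ⟩× 1 ∷ ⟨ 5 , 10 , 24 ⟩× 18 ∷ ⟨ 5 , 10 , 30 ⟩× 102 ∷ ⟨ 5 , 11 , 16 ⟩× 23 ∷ ⟨ 5 , 11 , 17 ⟩× 1 ∷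
    ⟨ 5 , 11 , 22 ⟩× 1 ∷ ⟨ 5 , 11 , 32 ⟩× 302 ∷ ⟨ 5 , 11 , 36 ⟩× 1 ∷ ⟨ 5 , 11 , 38 ⟩× 45 ∷ ⟨ 5 , 12 , 17 ⟩× 1 ∷ ⟨ 5 , 12 , 27 ⟩× 1 ∷
    ⟨ 5 , 14 , 24 ⟩× 141 ∷ ⟨ 5 , 14 , 28 ⟩× 1 ∷ ⟨ 5 , 14 , 34 ⟩× 50 ∷ ⟨ 5 , 15 , 16 ⟩× 206 ∷ ⟨ 5 , 15 , 20 ⟩× 9 ∷ ⟨ 5 , 15 , 22 ⟩× 18 ∷
    ⟨ 5 , 15 , 26 ⟩× 53 ∷ ⟨ 5 , 16 , 17 ⟩× 144 ∷ ⟨ 5 , 16 , 30 ⟩× 1 ∷ ⟨ 5 , 16 , 34 ⟩× 3 ∷ ⟨ 5 , 16 , 36 ⟩× 1 ∷ ⟨ 5 , 16 , 39 ⟩× 68 ∷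
    ⟨ 5 , 17 , 20 ⟩× 1 ∷ ⟨ 5 , 17 , 22 ⟩× 1 ∷ ⟨ 5 , 17 , 27 ⟩× 2 ∷ ⟨ 5 , 17 , 28 ⟩× 9 ∷ ⟨ 5 , 17 , 30 ⟩× 1 ∷ ⟨ 5 , 17 , 31 ⟩× 72 ∷
    ⟨ 5 , 17 , 32 ⟩× 16 ∷ ⟨ 5 , 17 , 36 ⟩× 4 ∷ ⟨ 5 , 17 , 39 ⟩× 34 ∷ ⟨ 5 , 18 , 22 ⟩× 1 ∷ ⟨ 5 , 18 , 23 ⟩× 26 ∷ ⟨ 5 , 18 , 24 ⟩× 11 ∷
    ⟨ 5 , 18 , 25 ⟩× 44 ∷ ⟨ 5 , 18 , 32 ⟩× 14 ∷ ⟨ 5 , 19 , 36 ⟩× 10 ∷ ⟨ 5 , 20 , 32 ⟩× 1 ∷ ⟨ 5 , 20 , 33 ⟩× 14 ∷ ⟨ 5 , 22 , 25 ⟩× 174 ∷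
    ⟨ 5 , 22 , 31 ⟩× 1 ∷ ⟨ 5 , 22 , 33 ⟩× 21 ∷ ⟨ 5 , 22 , 36 ⟩× 160 ∷ ⟨ 5 , 23 , 28 ⟩× 174 ∷ ⟨ 5 , 23 , 30 ⟩× 1 ∷ ⟨ 5 , 23 , 36 ⟩× 1 ∷
    ⟨ 5 , 24 , 33 ⟩× 50 ∷ ⟨ 5 , 24 , 36 ⟩× 1 ∷ ⟨ 5 , 24 , 39 ⟩× 88 ∷ ⟨ 5 , 25 , 30 ⟩× 60 ∷ ⟨ 5 , 25 , 34 ⟩× 113 ∷ ⟨ 5 , 26 , 30 ⟩× 2 ∷
    ⟨ 5 , 26 , 31 ⟩× 11 ∷ ⟨ 5 , 26 , 35 ⟩× 28 ∷ ⟨ 5 , 26 , 36 ⟩× 90 ∷ ⟨ 5 , 26 , 39 ⟩× 16 ∷ ⟨ 5 , 27 , 28 ⟩× 1 ∷ ⟨ 5 , 27 , 33 ⟩× 15 ∷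
    ⟨ 5 , 27 , 34 ⟩× 29 ∷ ⟨ 5 , 27 , 38 ⟩× 115 ∷ ⟨ 5 , 28 , 30 ⟩× 1 ∷ ⟨ 5 , 28 , 31 ⟩× 2 ∷ ⟨ 5 , 28 , 33 ⟩× 1 ∷ ⟨ 5 , 28 , 34 ⟩× 1 ∷
    ⟨ 5 , 28 , 39 ⟩× 5 ∷ ⟨ 5 , 30 , 34 ⟩× 12 ∷ ⟨ 5 , 30 , 39 ⟩× 250 ∷ ⟨ 5 , 31 , 35 ⟩× 315 ∷ ⟨ 5 , 31 , 36 ⟩× 32 ∷ ⟨ 5 , 32 , 38 ⟩× 1 ∷
    ⟨ 5 , 32 , 39 ⟩× 186 ∷ ⟨ 5 , 34 , 36 ⟩× 14 ∷ ⟨ 5 , 34 , 38 ⟩× 1 ∷ ⟨ 5 , 35 , 38 ⟩× 18 ∷ ⟨ 5 , 36 , 38 ⟩× 27 ∷ ⟨ 6 , 7 , 13 ⟩× 1 ∷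
    ⟨ 6 , 7 , 17 ⟩× 13 ∷ ⟨ 6 , 7 , 18 ⟩× 1 ∷ ⟨ 6 , 7 , 21 ⟩× 1 ∷ ⟨ 6 , 7 , 29 ⟩× 10 ∷ ⟨ 6 , 7 , 32 ⟩× 2 ∷ ⟨ 6 , 8 , 12 ⟩× 1 ∷
    ⟨ 6 , 8 , 19 ⟩× 1 ∷ ⟨ 6 , 8 , 27 ⟩× 1 ∷ ⟨ 6 , 8 , 29 ⟩× 119 ∷ ⟨ 6 , 8 , 31 ⟩× 20 ∷ ⟨ 6 , 8 , 33 ⟩× 3 ∷ ⟨ 6 , 8 , 36 ⟩× 51 ∷
    ⟨ 6 , 8 , 39 ⟩× 1 ∷ ⟨ 6 , 9 , 11 ⟩× 1 ∷ ⟨ 6 , 9 , 18 ⟩× 1 ∷ ⟨ 6 , 9 , 21 ⟩× 37 ∷ ⟨ 6 , 10 , 15 ⟩× 184 ∷ ⟨ 6 , 10 , 21 ⟩× 139 ∷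
    ⟨ 6 , 10 , 32 ⟩× 1 ∷ ⟨ 6 , 10 , 33 ⟩× 1 ∷ ⟨ 6 , 10 , 35 ⟩× 9 ∷ ⟨ 6 , 10 , 36 ⟩× 34 ∷ ⟨ 6 , 10 , 37 ⟩× 120 ∷ ⟨ 6 , 10 , 39 ⟩× 1 ∷
    ⟨ 6 , 11 , 12 ⟩× 12 ∷ ⟨ 6 , 11 , 15 ⟩× 89 ∷ ⟨ 6 , 11 , 25 ⟩× 28 ∷ ⟨ 6 , 11 , 34 ⟩× 11 ∷ ⟨ 6 , 11 , 37 ⟩× 54 ∷ ⟨ 6 , 12 , 18 ⟩× 31 ∷
    ⟨ 6 , 12 , 24 ⟩× 69 ∷ ⟨ 6 , 12 , 31 ⟩× 10 ∷ ⟨ 6 , 12 , 32 ⟩× 136 ∷ ⟨ 6 , 12 , 33 ⟩× 135 ∷ ⟨ 6 , 13 , 18 ⟩× 14 ∷ ⟨ 6 , 13 , 19 ⟩× 15 ∷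
    ⟨ 6 , 13 , 26 ⟩× 2 ∷ ⟨ 6 , 13 , 27 ⟩× 32 ∷ ⟨ 6 , 13 , 28 ⟩× 263 ∷ ⟨ 6 , 13 , 32 ⟩× 1 ∷ ⟨ 6 , 13 , 34 ⟩× 3 ∷ ⟨ 6 , 13 , 39 ⟩× 65 ∷
    ⟨ 6 , 15 , 18 ⟩× 3 ∷ ⟨ 6 , 15 , 20 ⟩× 320 ∷ ⟨ 6 , 15 , 21 ⟩× 39 ∷ ⟨ 6 , 15 , 25 ⟩× 16 ∷ ⟨ 6 , 15 , 28 ⟩× 13 ∷ ⟨ 6 , 16 , 20 ⟩× 112 ∷
    ⟨ 6 , 16 , 27 ⟩× 18 ∷ ⟨ 6 , 16 , 33 ⟩× 1 ∷ ⟨ 6 , 16 , 39 ⟩× 19 ∷ ⟨ 6 , 17 , 37 ⟩× 1 ∷ ⟨ 6 , 18 , 29 ⟩× 15 ∷ ⟨ 6 , 18 , 31 ⟩× 62 ∷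
    ⟨ 6 , 18 , 32 ⟩× 274 ∷ ⟨ 6 , 18 , 33 ⟩× 1 ∷ ⟨ 6 , 18 , 36 ⟩× 117 ∷ ⟨ 6 , 19 , 24 ⟩× 49 ∷ ⟨ 6 , 19 , 25 ⟩× 327 ∷ ⟨ 6 , 19 , 26 ⟩× 1 ∷
    ⟨ 6 , 19 , 28 ⟩× 66 ∷ ⟨ 6 , 19 , 32 ⟩× 2 ∷ ⟨ 6 , 19 , 36 ⟩× 184 ∷ ⟨ 6 , 20 , 24 ⟩× 18 ∷ ⟨ 6 , 20 , 39 ⟩× 145 ∷ ⟨ 6 , 21 , 23 ⟩× 1 ∷
    ⟨ 6 , 21 , 24 ⟩× 93 ∷ ⟨ 6 , 21 , 27 ⟩× 123 ∷ ⟨ 6 , 21 , 34 ⟩× 26 ∷ ⟨ 6 , 21 , 39 ⟩× 193 ∷ ⟨ 6 , 23 , 26 ⟩× 124 ∷ ⟨ 6 , 23 , 37 ⟩× 38 ∷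
    ⟨ 6 , 25 , 34 ⟩× 52 ∷ ⟨ 6 , 26 , 29 ⟩× 13 ∷ ⟨ 6 , 26 , 31 ⟩× 32 ∷ ⟨ 6 , 27 , 32 ⟩× 16 ∷ ⟨ 6 , 27 , 33 ⟩× 1 ∷ ⟨ 6 , 28 , 29 ⟩× 186 ∷
    ⟨ 6 , 28 , 35 ⟩× 54 ∷ ⟨ 6 , 28 , 39 ⟩× 3 ∷ ⟨ 6 , 29 , 32 ⟩× 61 ∷ ⟨ 6 , 31 , 32 ⟩× 2 ∷ ⟨ 6 , 32 , 33 ⟩× 11 ∷ ⟨ 6 , 33 , 35 ⟩× 32 ∷
    ⟨ 6 , 34 , 37 ⟩× 1 ∷ ⟨ 6 , 37 , 39 ⟩× 27 ∷ ⟨ 7 , 8 , 11 ⟩× 31 ∷ ⟨ 7 , 8 , 18 ⟩× 16 ∷ ⟨ 7 , 8 , 38 ⟩× 14 ∷ ⟨ 7 , 9 , 12 ⟩× 1 ∷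
    ⟨ 7 , 9 , 18 ⟩× 15 ∷ ⟨ 7 , 9 , 22 ⟩× 27 ∷ ⟨ 7 , 9 , 34 ⟩× 61 ∷ ⟨ 7 , 9 , 37 ⟩× 18 ∷ ⟨ 7 , 9 , 38 ⟩× 119 ∷ ⟨ 7 , 10 , 11 ⟩× 12 ∷
    ⟨ 7 , 10 , 16 ⟩× 10 ∷ ⟨ 7 , 10 , 19 ⟩× 1 ∷ ⟨ 7 , 10 , 22 ⟩× 55 ∷ ⟨ 7 , 10 , 25 ⟩× 115 ∷ ⟨ 7 , 10 , 27 ⟩× 14 ∷ ⟨ 7 , 10 , 37 ⟩× 128 ∷
    ⟨ 7 , 11 , 16 ⟩× 20 ∷ ⟨ 7 , 11 , 17 ⟩× 11 ∷ ⟨ 7 , 11 , 18 ⟩× 448 ∷ ⟨ 7 , 11 , 24 ⟩× 1 ∷ ⟨ 7 , 11 , 30 ⟩× 75 ∷ ⟨ 7 , 12 , 16 ⟩× 314 ∷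
    ⟨ 7 , 12 , 19 ⟩× 24 ∷ ⟨ 7 , 12 , 24 ⟩× 1 ∷ ⟨ 7 , 12 , 26 ⟩× 186 ∷ ⟨ 7 , 12 , 27 ⟩× 1 ∷ ⟨ 7 , 12 , 29 ⟩× 38 ∷ ⟨ 7 , 12 , 34 ⟩× 103 ∷
    ⟨ 7 , 12 , 35 ⟩× 1 ∷ ⟨ 7 , 13 , 20 ⟩× 19 ∷ ⟨ 7 , 13 , 24 ⟩× 36 ∷ ⟨ 7 , 13 , 30 ⟩× 22 ∷ ⟨ 7 , 13 , 34 ⟩× 1 ∷ ⟨ 7 , 13 , 38 ⟩× 60 ∷
    ⟨ 7 , 14 , 18 ⟩× 114 ∷ ⟨ 7 , 14 , 21 ⟩× 16 ∷ ⟨ 7 , 14 , 28 ⟩× 36 ∷ ⟨ 7 , 14 , 29 ⟩× 88 ∷ ⟨ 7 , 14 , 35 ⟩× 42 ∷ ⟨ 7 , 14 , 36 ⟩× 259 ∷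
    ⟨ 7 , 16 , 21 ⟩× 4 ∷ ⟨ 7 , 16 , 35 ⟩× 163 ∷ ⟨ 7 , 17 , 18 ⟩× 27 ∷ ⟨ 7 , 17 , 19 ⟩× 1 ∷ ⟨ 7 , 17 , 24 ⟩× 1 ∷ ⟨ 7 , 17 , 30 ⟩× 51 ∷
    ⟨ 7 , 17 , 35 ⟩× 1 ∷ ⟨ 7 , 17 , 36 ⟩× 173 ∷ ⟨ 7 , 18 , 32 ⟩× 58 ∷ ⟨ 7 , 18 , 33 ⟩× 1 ∷ ⟨ 7 , 19 , 24 ⟩× 1 ∷ ⟨ 7 , 19 , 26 ⟩× 1 ∷
    ⟨ 7 , 19 , 28 ⟩× 97 ∷ ⟨ 7 , 19 , 33 ⟩× 20 ∷ ⟨ 7 , 20 , 24 ⟩× 13 ∷ ⟨ 7 , 21 , 22 ⟩× 1 ∷ ⟨ 7 , 21 , 24 ⟩× 1 ∷ ⟨ 7 , 21 , 26 ⟩× 64 ∷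
    ⟨ 7 , 21 , 27 ⟩× 31 ∷ ⟨ 7 , 21 , 33 ⟩× 114 ∷ ⟨ 7 , 21 , 35 ⟩× 130 ∷ ⟨ 7 , 22 , 27 ⟩× 219 ∷ ⟨ 7 , 22 , 32 ⟩× 13 ∷ ⟨ 7 , 22 , 34 ⟩× 15 ∷
    ⟨ 7 , 22 , 35 ⟩× 110 ∷ ⟨ 7 , 24 , 25 ⟩× 57 ∷ ⟨ 7 , 24 , 36 ⟩× 14 ∷ ⟨ 7 , 25 , 26 ⟩× 17 ∷ ⟨ 7 , 25 , 37 ⟩× 194 ∷ ⟨ 7 , 26 , 32 ⟩× 129 ∷
    ⟨ 7 , 26 , 33 ⟩× 17 ∷ ⟨ 7 , 26 , 35 ⟩× 1 ∷ ⟨ 7 , 26 , 37 ⟩× 1 ∷ ⟨ 7 , 27 , 28 ⟩× 1 ∷ ⟨ 7 , 27 , 29 ⟩× 1 ∷ ⟨ 7 , 27 , 30 ⟩× 139 ∷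
    ⟨ 7 , 28 , 29 ⟩× 12 ∷ ⟨ 7 , 28 , 32 ⟩× 49 ∷ ⟨ 7 , 29 , 34 ⟩× 1 ∷ ⟨ 7 , 32 , 35 ⟩× 17 ∷ ⟨ 7 , 32 , 38 ⟩× 27 ∷ ⟨ 7 , 33 , 38 ⟩× 229 ∷
    ⟨ 7 , 34 , 35 ⟩× 30 ∷ ⟨ 7 , 35 , 38 ⟩× 19 ∷ ⟨ 8 , 9 , 14 ⟩× 14 ∷ ⟨ 8 , 9 , 15 ⟩× 36 ∷ ⟨ 8 , 9 , 18 ⟩× 2 ∷ ⟨ 8 , 9 , 20 ⟩× 72 ∷
    ⟨ 8 , 9 , 27 ⟩× 26 ∷ ⟨ 8 , 9 , 38 ⟩× 275 ∷ ⟨ 8 , 10 , 12 ⟩× 107 ∷ ⟨ 8 , 10 , 20 ⟩× 1 ∷ ⟨ 8 , 10 , 21 ⟩× 34 ∷ ⟨ 8 , 10 , 25 ⟩× 335 ∷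
    ⟨ 8 , 11 , 12 ⟩× 126 ∷ ⟨ 8 , 11 , 22 ⟩× 2 ∷ ⟨ 8 , 11 , 25 ⟩× 61 ∷ ⟨ 8 , 11 , 29 ⟩× 15 ∷ ⟨ 8 , 11 , 30 ⟩× 16 ∷ ⟨ 8 , 12 , 17 ⟩× 113 ∷
    ⟨ 8 , 12 , 21 ⟩× 27 ∷ ⟨ 8 , 12 , 22 ⟩× 46 ∷ ⟨ 8 , 13 , 14 ⟩× 140 ∷ ⟨ 8 , 13 , 18 ⟩× 398 ∷ ⟨ 8 , 13 , 25 ⟩× 23 ∷ ⟨ 8 , 13 , 31 ⟩× 35 ∷
    ⟨ 8 , 13 , 33 ⟩× 15 ∷ ⟨ 8 , 13 , 36 ⟩× 14 ∷ ⟨ 8 , 14 , 20 ⟩× 106 ∷ ⟨ 8 , 14 , 23 ⟩× 244 ∷ ⟨ 8 , 14 , 26 ⟩× 25 ∷ ⟨ 8 , 14 , 27 ⟩× 53 ∷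
    ⟨ 8 , 15 , 20 ⟩× 144 ∷ ⟨ 8 , 15 , 22 ⟩× 1 ∷ ⟨ 8 , 15 , 26 ⟩× 18 ∷ ⟨ 8 , 15 , 27 ⟩× 1 ∷ ⟨ 8 , 15 , 28 ⟩× 72 ∷ ⟨ 8 , 15 , 38 ⟩× 15 ∷
    ⟨ 8 , 17 , 20 ⟩× 1 ∷ ⟨ 8 , 17 , 23 ⟩× 1 ∷ ⟨ 8 , 17 , 31 ⟩× 16 ∷ ⟨ 8 , 17 , 34 ⟩× 56 ∷ ⟨ 8 , 17 , 36 ⟩× 22 ∷ ⟨ 8 , 17 , 37 ⟩× 17 ∷
    ⟨ 8 , 18 , 22 ⟩× 18 ∷ ⟨ 8 , 18 , 23 ⟩× 71 ∷ ⟨ 8 , 18 , 28 ⟩× 179 ∷ ⟨ 8 , 19 , 25 ⟩× 24 ∷ ⟨ 8 , 19 , 28 ⟩× 17 ∷ ⟨ 8 , 19 , 33 ⟩× 35 ∷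
    ⟨ 8 , 20 , 22 ⟩× 13 ∷ ⟨ 8 , 20 , 23 ⟩× 3 ∷ ⟨ 8 , 20 , 27 ⟩× 1 ∷ ⟨ 8 , 20 , 29 ⟩× 61 ∷ ⟨ 8 , 20 , 31 ⟩× 1 ∷ ⟨ 8 , 20 , 38 ⟩× 1 ∷
    ⟨ 8 , 21 , 30 ⟩× 1 ∷ ⟨ 8 , 21 , 38 ⟩× 1 ∷ ⟨ 8 , 21 , 39 ⟩× 14 ∷ ⟨ 8 , 22 , 29 ⟩× 1 ∷ ⟨ 8 , 23 , 28 ⟩× 19 ∷ ⟨ 8 , 23 , 30 ⟩× 39 ∷
    ⟨ 8 , 23 , 34 ⟩× 16 ∷ ⟨ 8 , 23 , 36 ⟩× 95 ∷ ⟨ 8 , 25 , 31 ⟩× 47 ∷ ⟨ 8 , 26 , 29 ⟩× 1 ∷ ⟨ 8 , 27 , 37 ⟩× 18 ∷ ⟨ 8 , 27 , 38 ⟩× 1 ∷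
    ⟨ 8 , 27 , 39 ⟩× 14 ∷ ⟨ 8 , 29 , 33 ⟩× 70 ∷ ⟨ 8 , 29 , 34 ⟩× 1 ∷ ⟨ 8 , 29 , 36 ⟩× 12 ∷ ⟨ 8 , 29 , 38 ⟩× 1 ∷ ⟨ 8 , 30 , 31 ⟩× 1 ∷
    ⟨ 8 , 30 , 35 ⟩× 15 ∷ ⟨ 8 , 30 , 36 ⟩× 192 ∷ ⟨ 8 , 30 , 39 ⟩× 61 ∷ ⟨ 8 , 33 , 38 ⟩× 18 ∷ ⟨ 8 , 34 , 38 ⟩× 151 ∷ ⟨ 8 , 34 , 39 ⟩× 2 ∷
    ⟨ 8 , 35 , 37 ⟩× 64 ∷ ⟨ 8 , 35 , 38 ⟩× 75 ∷ ⟨ 8 , 35 , 39 ⟩× 31 ∷ ⟨ 8 , 36 , 39 ⟩× 3 ∷ ⟨ 9 , 10 , 16 ⟩× 1 ∷ ⟨ 9 , 10 , 19 ⟩× 39 ∷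
    ⟨ 9 , 10 , 20 ⟩× 19 ∷ ⟨ 9 , 10 , 38 ⟩× 20 ∷ ⟨ 9 , 10 , 39 ⟩× 59 ∷ ⟨ 9 , 11 , 12 ⟩× 56 ∷ ⟨ 9 , 11 , 22 ⟩× 68 ∷ ⟨ 9 , 11 , 28 ⟩× 17 ∷
    ⟨ 9 , 12 , 15 ⟩× 29 ∷ ⟨ 9 , 12 , 16 ⟩× 1 ∷ ⟨ 9 , 12 , 18 ⟩× 1 ∷ ⟨ 9 , 12 , 19 ⟩× 1 ∷ ⟨ 9 , 12 , 24 ⟩× 3 ∷ ⟨ 9 , 12 , 34 ⟩× 1 ∷
    ⟨ 9 , 12 , 37 ⟩× 1 ∷ ⟨ 9 , 12 , 38 ⟩× 16 ∷ ⟨ 9 , 13 , 16 ⟩× 1 ∷ ⟨ 9 , 13 , 22 ⟩× 137 ∷ ⟨ 9 , 13 , 28 ⟩× 85 ∷ ⟨ 9 , 13 , 32 ⟩× 16 ∷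
    ⟨ 9 , 13 , 34 ⟩× 167 ∷ ⟨ 9 , 14 , 20 ⟩× 18 ∷ ⟨ 9 , 14 , 21 ⟩× 182 ∷ ⟨ 9 , 14 , 26 ⟩× 91 ∷ ⟨ 9 , 14 , 34 ⟩× 12 ∷ ⟨ 9 , 14 , 35 ⟩× 317 ∷
    ⟨ 9 , 14 , 36 ⟩× 47 ∷ ⟨ 9 , 15 , 18 ⟩× 11 ∷ ⟨ 9 , 15 , 19 ⟩× 153 ∷ ⟨ 9 , 15 , 35 ⟩× 18 ∷ ⟨ 9 , 16 , 20 ⟩× 1 ∷ ⟨ 9 , 16 , 31 ⟩× 2 ∷
    ⟨ 9 , 16 , 39 ⟩× 1 ∷ ⟨ 9 , 18 , 19 ⟩× 62 ∷ ⟨ 9 , 18 , 20 ⟩× 1 ∷ ⟨ 9 , 18 , 21 ⟩× 1 ∷ ⟨ 9 , 18 , 30 ⟩× 5 ∷ ⟨ 9 , 18 , 37 ⟩× 26 ∷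
    ⟨ 9 , 19 , 30 ⟩× 207 ∷ ⟨ 9 , 19 , 32 ⟩× 18 ∷ ⟨ 9 , 19 , 34 ⟩× 23 ∷ ⟨ 9 , 20 , 26 ⟩× 32 ∷ ⟨ 9 , 20 , 35 ⟩× 1 ∷ ⟨ 9 , 21 , 26 ⟩× 2 ∷
    ⟨ 9 , 21 , 28 ⟩× 111 ∷ ⟨ 9 , 21 , 31 ⟩× 1 ∷ ⟨ 9 , 21 , 38 ⟩× 33 ∷ ⟨ 9 , 21 , 39 ⟩× 43 ∷ ⟨ 9 , 22 , 28 ⟩× 20 ∷ ⟨ 9 , 22 , 34 ⟩× 11 ∷
    ⟨ 9 , 22 , 39 ⟩× 11 ∷ ⟨ 9 , 23 , 26 ⟩× 11 ∷ ⟨ 9 , 23 , 28 ⟩× 1 ∷ ⟨ 9 , 23 , 30 ⟩× 49 ∷ ⟨ 9 , 23 , 35 ⟩× 36 ∷ ⟨ 9 , 24 , 28 ⟩× 35 ∷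
    ⟨ 9 , 24 , 36 ⟩× 265 ∷ ⟨ 9 , 24 , 37 ⟩× 56 ∷ ⟨ 9 , 24 , 39 ⟩× 21 ∷ ⟨ 9 , 26 , 28 ⟩× 202 ∷ ⟨ 9 , 26 , 30 ⟩× 15 ∷ ⟨ 9 , 26 , 31 ⟩× 2 ∷
    ⟨ 9 , 26 , 35 ⟩× 1 ∷ ⟨ 9 , 26 , 39 ⟩× 1 ∷ ⟨ 9 , 27 , 34 ⟩× 47 ∷ ⟨ 9 , 27 , 36 ⟩× 12 ∷ ⟨ 9 , 30 , 32 ⟩× 34 ∷ ⟨ 9 , 30 , 36 ⟩× 107 ∷
    ⟨ 9 , 31 , 38 ⟩× 1 ∷ ⟨ 9 , 35 , 38 ⟩× 84 ∷ ⟨ 9 , 36 , 37 ⟩× 18 ∷ ⟨ 10 , 11 , 22 ⟩× 1 ∷ ⟨ 10 , 11 , 24 ⟩× 1 ∷ ⟨ 10 , 11 , 32 ⟩× 12 ∷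
    ⟨ 10 , 11 , 37 ⟩× 25 ∷ ⟨ 10 , 12 , 21 ⟩× 4 ∷ ⟨ 10 , 12 , 24 ⟩× 39 ∷ ⟨ 10 , 12 , 27 ⟩× 149 ∷ ⟨ 10 , 13 , 22 ⟩× 14 ∷ ⟨ 10 , 13 , 23 ⟩× 103 ∷
    ⟨ 10 , 14 , 16 ⟩× 17 ∷ ⟨ 10 , 14 , 17 ⟩× 2 ∷ ⟨ 10 , 14 , 25 ⟩× 13 ∷ ⟨ 10 , 14 , 31 ⟩× 14 ∷ ⟨ 10 , 15 , 16 ⟩× 1 ∷ ⟨ 10 , 15 , 36 ⟩× 125 ∷
    ⟨ 10 , 16 , 20 ⟩× 1 ∷ ⟨ 10 , 16 , 21 ⟩× 2 ∷ ⟨ 10 , 16 , 27 ⟩× 54 ∷ ⟨ 10 , 16 , 28 ⟩× 178 ∷ ⟨ 10 , 16 , 29 ⟩× 1 ∷ ⟨ 10 , 16 , 30 ⟩× 2 ∷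
    ⟨ 10 , 16 , 31 ⟩× 102 ∷ ⟨ 10 , 16 , 35 ⟩× 1 ∷ ⟨ 10 , 16 , 37 ⟩× 2 ∷ ⟨ 10 , 16 , 39 ⟩× 1 ∷ ⟨ 10 , 17 , 22 ⟩× 34 ∷ ⟨ 10 , 17 , 23 ⟩× 178 ∷
    ⟨ 10 , 17 , 28 ⟩× 34 ∷ ⟨ 10 , 17 , 38 ⟩× 1 ∷ ⟨ 10 , 17 , 39 ⟩× 82 ∷ ⟨ 10 , 19 , 22 ⟩× 14 ∷ ⟨ 10 , 19 , 25 ⟩× 24 ∷ ⟨ 10 , 19 , 36 ⟩× 103 ∷
    ⟨ 10 , 20 , 27 ⟩× 1 ∷ ⟨ 10 , 20 , 32 ⟩× 1 ∷ ⟨ 10 , 21 , 33 ⟩× 85 ∷ ⟨ 10 , 21 , 39 ⟩× 1 ∷ ⟨ 10 , 22 , 23 ⟩× 350 ∷ ⟨ 10 , 22 , 27 ⟩× 1 ∷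
    ⟨ 10 , 22 , 35 ⟩× 23 ∷ ⟨ 10 , 23 , 33 ⟩× 2 ∷ ⟨ 10 , 24 , 28 ⟩× 46 ∷ ⟨ 10 , 24 , 30 ⟩× 3 ∷ ⟨ 10 , 24 , 31 ⟩× 123 ∷ ⟨ 10 , 25 , 36 ⟩× 49 ∷
    ⟨ 10 , 27 , 28 ⟩× 89 ∷ ⟨ 10 , 27 , 29 ⟩× 31 ∷ ⟨ 10 , 27 , 31 ⟩× 320 ∷ ⟨ 10 , 27 , 39 ⟩× 17 ∷ ⟨ 10 , 28 , 31 ⟩× 1 ∷ ⟨ 10 , 28 , 38 ⟩× 9 ∷
    ⟨ 10 , 29 , 31 ⟩× 20 ∷ ⟨ 10 , 29 , 38 ⟩× 65 ∷ ⟨ 10 , 29 , 39 ⟩× 15 ∷ ⟨ 10 , 30 , 31 ⟩× 26 ∷ ⟨ 10 , 30 , 32 ⟩× 4 ∷ ⟨ 10 , 30 , 35 ⟩× 1 ∷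
    ⟨ 10 , 30 , 36 ⟩× 1 ∷ ⟨ 10 , 30 , 37 ⟩× 12 ∷ ⟨ 10 , 30 , 39 ⟩× 200 ∷ ⟨ 10 , 31 , 35 ⟩× 1 ∷ ⟨ 10 , 31 , 38 ⟩× 42 ∷ ⟨ 10 , 32 , 36 ⟩× 23 ∷
    ⟨ 10 , 32 , 38 ⟩× 1 ∷ ⟨ 10 , 33 , 39 ⟩× 27 ∷ ⟨ 10 , 36 , 38 ⟩× 12 ∷ ⟨ 10 , 37 , 38 ⟩× 1 ∷ ⟨ 11 , 12 , 17 ⟩× 1 ∷ ⟨ 11 , 12 , 21 ⟩× 1 ∷
    ⟨ 11 , 12 , 22 ⟩× 267 ∷ ⟨ 11 , 12 , 24 ⟩× 91 ∷ ⟨ 11 , 12 , 26 ⟩× 22 ∷ ⟨ 11 , 13 , 20 ⟩× 1 ∷ ⟨ 11 , 13 , 25 ⟩× 1 ∷ ⟨ 11 , 13 , 31 ⟩× 79 ∷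
    ⟨ 11 , 13 , 34 ⟩× 42 ∷ ⟨ 11 , 13 , 36 ⟩× 1 ∷ ⟨ 11 , 13 , 38 ⟩× 36 ∷ ⟨ 11 , 14 , 17 ⟩× 130 ∷ ⟨ 11 , 14 , 18 ⟩× 17 ∷ ⟨ 11 , 14 , 23 ⟩× 24 ∷
    ⟨ 11 , 14 , 24 ⟩× 14 ∷ ⟨ 11 , 14 , 26 ⟩× 51 ∷ ⟨ 11 , 14 , 28 ⟩× 1 ∷ ⟨ 11 , 15 , 16 ⟩× 2 ∷ ⟨ 11 , 15 , 20 ⟩× 11 ∷ ⟨ 11 , 15 , 22 ⟩× 1 ∷
    ⟨ 11 , 15 , 30 ⟩× 305 ∷ ⟨ 11 , 15 , 33 ⟩× 40 ∷ ⟨ 11 , 16 , 28 ⟩× 1 ∷ ⟨ 11 , 16 , 31 ⟩× 36 ∷ ⟨ 11 , 16 , 39 ⟩× 1 ∷ ⟨ 11 , 17 , 20 ⟩× 75 ∷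
    ⟨ 11 , 17 , 22 ⟩× 17 ∷ ⟨ 11 , 17 , 23 ⟩× 13 ∷ ⟨ 11 , 17 , 24 ⟩× 42 ∷ ⟨ 11 , 17 , 38 ⟩× 1 ∷ ⟨ 11 , 18 , 28 ⟩× 15 ∷ ⟨ 11 , 18 , 30 ⟩× 1 ∷
    ⟨ 11 , 18 , 33 ⟩× 41 ∷ ⟨ 11 , 20 , 21 ⟩× 28 ∷ ⟨ 11 , 20 , 31 ⟩× 129 ∷ ⟨ 11 , 20 , 32 ⟩× 1 ∷ ⟨ 11 , 20 , 37 ⟩× 12 ∷ ⟨ 11 , 21 , 23 ⟩× 100 ∷
    ⟨ 11 , 21 , 24 ⟩× 195 ∷ ⟨ 11 , 21 , 25 ⟩× 17 ∷ ⟨ 11 , 21 , 26 ⟩× 5 ∷ ⟨ 11 , 21 , 34 ⟩× 17 ∷ ⟨ 11 , 21 , 38 ⟩× 65 ∷ ⟨ 11 , 22 , 23 ⟩× 138 ∷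
    ⟨ 11 , 22 , 24 ⟩× 31 ∷ ⟨ 11 , 22 , 29 ⟩× 1 ∷ ⟨ 11 , 22 , 32 ⟩× 1 ∷ ⟨ 11 , 22 , 37 ⟩× 3 ∷ ⟨ 11 , 23 , 26 ⟩× 13 ∷ ⟨ 11 , 23 , 28 ⟩× 51 ∷
    ⟨ 11 , 23 , 30 ⟩× 1 ∷ ⟨ 11 , 23 , 34 ⟩× 1 ∷ ⟨ 11 , 24 , 29 ⟩× 262 ∷ ⟨ 11 , 24 , 37 ⟩× 14 ∷ ⟨ 11 , 25 , 26 ⟩× 123 ∷ ⟨ 11 , 25 , 38 ⟩× 1 ∷
    ⟨ 11 , 26 , 28 ⟩× 103 ∷ ⟨ 11 , 26 , 32 ⟩× 12 ∷ ⟨ 11 , 29 , 30 ⟩× 130 ∷ ⟨ 11 , 29 , 32 ⟩× 31 ∷ ⟨ 11 , 29 , 34 ⟩× 65 ∷ ⟨ 11 , 29 , 36 ⟩× 1 ∷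
    ⟨ 11 , 29 , 39 ⟩× 3 ∷ ⟨ 11 , 30 , 36 ⟩× 41 ∷ ⟨ 11 , 32 , 36 ⟩× 220 ∷ ⟨ 11 , 33 , 36 ⟩× 18 ∷ ⟨ 11 , 33 , 37 ⟩× 85 ∷ ⟨ 11 , 34 , 37 ⟩× 157 ∷
    ⟨ 11 , 34 , 39 ⟩× 1 ∷ ⟨ 11 , 36 , 39 ⟩× 4 ∷ ⟨ 12 , 13 , 17 ⟩× 1 ∷ ⟨ 12 , 13 , 25 ⟩× 3 ∷ ⟨ 12 , 13 , 30 ⟩× 15 ∷ ⟨ 12 , 13 , 34 ⟩× 18 ∷
    ⟨ 12 , 14 , 26 ⟩× 1 ∷ ⟨ 12 , 15 , 16 ⟩× 98 ∷ ⟨ 12 , 15 , 19 ⟩× 14 ∷ ⟨ 12 , 15 , 27 ⟩× 25 ∷ ⟨ 12 , 15 , 30 ⟩× 81 ∷ ⟨ 12 , 16 , 17 ⟩× 25 ∷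
    ⟨ 12 , 16 , 21 ⟩× 14 ∷ ⟨ 12 , 16 , 25 ⟩× 1 ∷ ⟨ 12 , 16 , 30 ⟩× 42 ∷ ⟨ 12 , 16 , 33 ⟩× 118 ∷ ⟨ 12 , 17 , 21 ⟩× 3 ∷ ⟨ 12 , 17 , 22 ⟩× 67 ∷
    ⟨ 12 , 17 , 23 ⟩× 107 ∷ ⟨ 12 , 17 , 26 ⟩× 50 ∷ ⟨ 12 , 17 , 29 ⟩× 20 ∷ ⟨ 12 , 18 , 24 ⟩× 117 ∷ ⟨ 12 , 18 , 25 ⟩× 1 ∷ ⟨ 12 , 18 , 27 ⟩× 50 ∷
    ⟨ 12 , 18 , 38 ⟩× 17 ∷ ⟨ 12 , 18 , 39 ⟩× 17 ∷ ⟨ 12 , 19 , 24 ⟩× 14 ∷ ⟨ 12 , 21 , 27 ⟩× 66 ∷ ⟨ 12 , 21 , 30 ⟩× 1 ∷ ⟨ 12 , 21 , 32 ⟩× 2 ∷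
    ⟨ 12 , 21 , 33 ⟩× 2 ∷ ⟨ 12 , 21 , 35 ⟩× 34 ∷ ⟨ 12 , 22 , 25 ⟩× 2 ∷ ⟨ 12 , 22 , 27 ⟩× 12 ∷ ⟨ 12 , 22 , 33 ⟩× 1 ∷ ⟨ 12 , 22 , 35 ⟩× 13 ∷
    ⟨ 12 , 23 , 32 ⟩× 20 ∷ ⟨ 12 , 23 , 33 ⟩× 55 ∷ ⟨ 12 , 23 , 34 ⟩× 167 ∷ ⟨ 12 , 23 , 37 ⟩× 7 ∷ ⟨ 12 , 24 , 25 ⟩× 1 ∷ ⟨ 12 , 24 , 29 ⟩× 125 ∷
    ⟨ 12 , 24 , 31 ⟩× 11 ∷ ⟨ 12 , 24 , 33 ⟩× 2 ∷ ⟨ 12 , 25 , 26 ⟩× 2 ∷ ⟨ 12 , 25 , 27 ⟩× 100 ∷ ⟨ 12 , 25 , 30 ⟩× 28 ∷ ⟨ 12 , 25 , 32 ⟩× 1 ∷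
    ⟨ 12 , 25 , 34 ⟩× 207 ∷ ⟨ 12 , 25 , 37 ⟩× 12 ∷ ⟨ 12 , 25 , 38 ⟩× 1 ∷ ⟨ 12 , 26 , 35 ⟩× 5 ∷ ⟨ 12 , 27 , 32 ⟩× 1 ∷ ⟨ 12 , 27 , 33 ⟩× 222 ∷
    ⟨ 12 , 29 , 33 ⟩× 1 ∷ ⟨ 12 , 29 , 38 ⟩× 51 ∷ ⟨ 12 , 30 , 32 ⟩× 18 ∷ ⟨ 12 , 30 , 34 ⟩× 1 ∷ ⟨ 12 , 32 , 34 ⟩× 43 ∷ ⟨ 12 , 32 , 35 ⟩× 68 ∷
    ⟨ 12 , 33 , 34 ⟩× 11 ∷ ⟨ 12 , 33 , 37 ⟩× 2 ∷ ⟨ 12 , 33 , 38 ⟩× 42 ∷ ⟨ 12 , 33 , 39 ⟩× 1 ∷ ⟨ 12 , 34 , 35 ⟩× 121 ∷ ⟨ 12 , 35 , 37 ⟩× 17 ∷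
    ⟨ 12 , 37 , 39 ⟩× 5 ∷ ⟨ 13 , 14 , 26 ⟩× 8 ∷ ⟨ 13 , 14 , 27 ⟩× 17 ∷ ⟨ 13 , 14 , 31 ⟩× 55 ∷ ⟨ 13 , 14 , 33 ⟩× 231 ∷ ⟨ 13 , 14 , 39 ⟩× 61 ∷
    ⟨ 13 , 15 , 18 ⟩× 1 ∷ ⟨ 13 , 15 , 25 ⟩× 42 ∷ ⟨ 13 , 15 , 26 ⟩× 2 ∷ ⟨ 13 , 15 , 28 ⟩× 13 ∷ ⟨ 13 , 15 , 32 ⟩× 85 ∷ ⟨ 13 , 15 , 34 ⟩× 271 ∷
    ⟨ 13 , 15 , 35 ⟩× 19 ∷ ⟨ 13 , 15 , 38 ⟩× 110 ∷ ⟨ 13 , 16 , 19 ⟩× 19 ∷ ⟨ 13 , 16 , 26 ⟩× 90 ∷ ⟨ 13 , 16 , 33 ⟩× 45 ∷ ⟨ 13 , 16 , 35 ⟩× 10 ∷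
    ⟨ 13 , 16 , 39 ⟩× 1 ∷ ⟨ 13 , 17 , 18 ⟩× 15 ∷ ⟨ 13 , 17 , 19 ⟩× 13 ∷ ⟨ 13 , 17 , 24 ⟩× 97 ∷ ⟨ 13 , 17 , 27 ⟩× 2 ∷ ⟨ 13 , 17 , 30 ⟩× 35 ∷
    ⟨ 13 , 18 , 22 ⟩× 190 ∷ ⟨ 13 , 18 , 32 ⟩× 49 ∷ ⟨ 13 , 18 , 36 ⟩× 25 ∷ ⟨ 13 , 19 , 26 ⟩× 1 ∷ ⟨ 13 , 19 , 34 ⟩× 3 ∷ ⟨ 13 , 20 , 27 ⟩× 13 ∷
    ⟨ 13 , 20 , 35 ⟩× 1 ∷ ⟨ 13 , 22 , 24 ⟩× 24 ∷ ⟨ 13 , 22 , 26 ⟩× 50 ∷ ⟨ 13 , 22 , 36 ⟩× 80 ∷ ⟨ 13 , 23 , 30 ⟩× 15 ∷ ⟨ 13 , 23 , 33 ⟩× 118 ∷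
    ⟨ 13 , 24 , 25 ⟩× 20 ∷ ⟨ 13 , 24 , 28 ⟩× 3 ∷ ⟨ 13 , 24 , 36 ⟩× 127 ∷ ⟨ 13 , 24 , 38 ⟩× 249 ∷ ⟨ 13 , 25 , 30 ⟩× 88 ∷ ⟨ 13 , 26 , 28 ⟩× 13 ∷
    ⟨ 13 , 27 , 28 ⟩× 1 ∷ ⟨ 13 , 27 , 31 ⟩× 16 ∷ ⟨ 13 , 27 , 34 ⟩× 1 ∷ ⟨ 13 , 28 , 32 ⟩× 225 ∷ ⟨ 13 , 28 , 35 ⟩× 56 ∷ ⟨ 13 , 31 , 33 ⟩× 18 ∷
    ⟨ 13 , 31 , 34 ⟩× 1 ∷ ⟨ 13 , 31 , 36 ⟩× 204 ∷ ⟨ 13 , 32 , 36 ⟩× 15 ∷ ⟨ 13 , 33 , 36 ⟩× 33 ∷ ⟨ 13 , 34 , 36 ⟩× 1 ∷ ⟨ 14 , 15 , 17 ⟩× 1 ∷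
    ⟨ 14 , 15 , 18 ⟩× 189 ∷ ⟨ 14 , 15 , 25 ⟩× 16 ∷ ⟨ 14 , 15 , 32 ⟩× 17 ∷ ⟨ 14 , 15 , 35 ⟩× 73 ∷ ⟨ 14 , 15 , 36 ⟩× 1 ∷ ⟨ 14 , 15 , 37 ⟩× 50 ∷
    ⟨ 14 , 16 , 23 ⟩× 70 ∷ ⟨ 14 , 16 , 27 ⟩× 108 ∷ ⟨ 14 , 16 , 31 ⟩× 201 ∷ ⟨ 14 , 16 , 33 ⟩× 53 ∷ ⟨ 14 , 17 , 19 ⟩× 1 ∷ ⟨ 14 , 17 , 20 ⟩× 24 ∷
    ⟨ 14 , 17 , 21 ⟩× 53 ∷ ⟨ 14 , 17 , 28 ⟩× 2 ∷ ⟨ 14 , 17 , 36 ⟩× 1 ∷ ⟨ 14 , 17 , 37 ⟩× 1 ∷ ⟨ 14 , 17 , 39 ⟩× 31 ∷ ⟨ 14 , 18 , 24 ⟩× 83 ∷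
    ⟨ 14 , 18 , 28 ⟩× 1 ∷ ⟨ 14 , 18 , 29 ⟩× 31 ∷ ⟨ 14 , 18 , 33 ⟩× 1 ∷ ⟨ 14 , 19 , 23 ⟩× 1 ∷ ⟨ 14 , 19 , 24 ⟩× 252 ∷ ⟨ 14 , 19 , 25 ⟩× 96 ∷
    ⟨ 14 , 19 , 28 ⟩× 1 ∷ ⟨ 14 , 19 , 29 ⟩× 16 ∷ ⟨ 14 , 19 , 33 ⟩× 129 ∷ ⟨ 14 , 19 , 36 ⟩× 1 ∷ ⟨ 14 , 19 , 37 ⟩× 15 ∷ ⟨ 14 , 20 , 31 ⟩× 14 ∷
    ⟨ 14 , 20 , 32 ⟩× 42 ∷ ⟨ 14 , 20 , 33 ⟩× 81 ∷ ⟨ 14 , 21 , 31 ⟩× 26 ∷ ⟨ 14 , 21 , 36 ⟩× 12 ∷ ⟨ 14 , 23 , 29 ⟩× 52 ∷ ⟨ 14 , 23 , 32 ⟩× 102 ∷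
    ⟨ 14 , 23 , 34 ⟩× 13 ∷ ⟨ 14 , 24 , 28 ⟩× 1 ∷ ⟨ 14 , 25 , 27 ⟩× 230 ∷ ⟨ 14 , 25 , 28 ⟩× 2 ∷ ⟨ 14 , 25 , 36 ⟩× 103 ∷ ⟨ 14 , 26 , 32 ⟩× 13 ∷
    ⟨ 14 , 26 , 39 ⟩× 193 ∷ ⟨ 14 , 27 , 28 ⟩× 2 ∷ ⟨ 14 , 27 , 31 ⟩× 90 ∷ ⟨ 14 , 27 , 36 ⟩× 22 ∷ ⟨ 14 , 28 , 29 ⟩× 2 ∷ ⟨ 14 , 28 , 31 ⟩× 1 ∷
    ⟨ 14 , 29 , 34 ⟩× 1 ∷ ⟨ 14 , 29 , 35 ⟩× 178 ∷ ⟨ 14 , 31 , 36 ⟩× 1 ∷ ⟨ 14 , 32 , 37 ⟩× 30 ∷ ⟨ 14 , 33 , 34 ⟩× 23 ∷ ⟨ 14 , 34 , 36 ⟩× 1 ∷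
    ⟨ 14 , 35 , 36 ⟩× 1 ∷ ⟨ 14 , 35 , 37 ⟩× 20 ∷ ⟨ 15 , 16 , 18 ⟩× 42 ∷ ⟨ 15 , 16 , 22 ⟩× 1 ∷ ⟨ 15 , 16 , 27 ⟩× 11 ∷ ⟨ 15 , 16 , 35 ⟩× 2 ∷
    ⟨ 15 , 16 , 36 ⟩× 13 ∷ ⟨ 15 , 16 , 38 ⟩× 2 ∷ ⟨ 15 , 17 , 20 ⟩× 15 ∷ ⟨ 15 , 17 , 24 ⟩× 16 ∷ ⟨ 15 , 17 , 27 ⟩× 1 ∷ ⟨ 15 , 18 , 20 ⟩× 2 ∷
    ⟨ 15 , 18 , 22 ⟩× 1 ∷ ⟨ 15 , 18 , 27 ⟩× 2 ∷ ⟨ 15 , 18 , 30 ⟩× 148 ∷ ⟨ 15 , 18 , 32 ⟩× 20 ∷ ⟨ 15 , 18 , 33 ⟩× 60 ∷ ⟨ 15 , 18 , 37 ⟩× 2 ∷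
    ⟨ 15 , 19 , 29 ⟩× 17 ∷ ⟨ 15 , 19 , 38 ⟩× 27 ∷ ⟨ 15 , 20 , 21 ⟩× 58 ∷ ⟨ 15 , 20 , 25 ⟩× 84 ∷ ⟨ 15 , 21 , 24 ⟩× 12 ∷ ⟨ 15 , 21 , 26 ⟩× 124 ∷
    ⟨ 15 , 21 , 28 ⟩× 163 ∷ ⟨ 15 , 21 , 30 ⟩× 16 ∷ ⟨ 15 , 22 , 24 ⟩× 78 ∷ ⟨ 15 , 22 , 26 ⟩× 1 ∷ ⟨ 15 , 22 , 27 ⟩× 1 ∷ ⟨ 15 , 22 , 32 ⟩× 39 ∷
    ⟨ 15 , 22 , 36 ⟩× 20 ∷ ⟨ 15 , 25 , 26 ⟩× 31 ∷ ⟨ 15 , 25 , 27 ⟩× 1 ∷ ⟨ 15 , 25 , 32 ⟩× 216 ∷ ⟨ 15 , 25 , 38 ⟩× 168 ∷ ⟨ 15 , 26 , 35 ⟩× 1 ∷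
    ⟨ 15 , 27 , 29 ⟩× 5 ∷ ⟨ 15 , 27 , 36 ⟩× 47 ∷ ⟨ 15 , 28 , 38 ⟩× 46 ∷ ⟨ 15 , 29 , 33 ⟩× 20 ∷ ⟨ 15 , 29 , 34 ⟩× 207 ∷ ⟨ 15 , 30 , 35 ⟩× 35 ∷
    ⟨ 15 , 30 , 37 ⟩× 14 ∷ ⟨ 15 , 32 , 36 ⟩× 1 ∷ ⟨ 15 , 34 , 36 ⟩× 15 ∷ ⟨ 15 , 34 , 37 ⟩× 35 ∷ ⟨ 15 , 36 , 37 ⟩× 94 ∷ ⟨ 16 , 17 , 21 ⟩× 111 ∷
    ⟨ 16 , 17 , 28 ⟩× 55 ∷ ⟨ 16 , 17 , 30 ⟩× 15 ∷ ⟨ 16 , 17 , 35 ⟩× 2 ∷ ⟨ 16 , 18 , 19 ⟩× 20 ∷ ⟨ 16 , 18 , 22 ⟩× 104 ∷ ⟨ 16 , 18 , 25 ⟩× 85 ∷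
    ⟨ 16 , 18 , 35 ⟩× 273 ∷ ⟨ 16 , 18 , 39 ⟩× 2 ∷ ⟨ 16 , 19 , 28 ⟩× 33 ∷ ⟨ 16 , 19 , 29 ⟩× 56 ∷ ⟨ 16 , 19 , 30 ⟩× 165 ∷ ⟨ 16 , 19 , 34 ⟩× 128 ∷
    ⟨ 16 , 20 , 21 ⟩× 1 ∷ ⟨ 16 , 20 , 26 ⟩× 17 ∷ ⟨ 16 , 20 , 27 ⟩× 148 ∷ ⟨ 16 , 20 , 34 ⟩× 15 ∷ ⟨ 16 , 21 , 23 ⟩× 3 ∷ ⟨ 16 , 21 , 25 ⟩× 45 ∷
    ⟨ 16 , 21 , 30 ⟩× 76 ∷ ⟨ 16 , 21 , 33 ⟩× 18 ∷ ⟨ 16 , 21 , 35 ⟩× 1 ∷ ⟨ 16 , 21 , 36 ⟩× 1 ∷ ⟨ 16 , 21 , 39 ⟩× 280 ∷ ⟨ 16 , 22 , 27 ⟩× 25 ∷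
    ⟨ 16 , 22 , 35 ⟩× 13 ∷ ⟨ 16 , 23 , 28 ⟩× 19 ∷ ⟨ 16 , 23 , 34 ⟩× 42 ∷ ⟨ 16 , 23 , 38 ⟩× 20 ∷ ⟨ 16 , 25 , 35 ⟩× 1 ∷ ⟨ 16 , 25 , 37 ⟩× 14 ∷
    ⟨ 16 , 25 , 39 ⟩× 12 ∷ ⟨ 16 , 26 , 37 ⟩× 61 ∷ ⟨ 16 , 26 , 39 ⟩× 175 ∷ ⟨ 16 , 28 , 29 ⟩× 80 ∷ ⟨ 16 , 28 , 30 ⟩× 12 ∷ ⟨ 16 , 28 , 34 ⟩× 13 ∷
    ⟨ 16 , 29 , 30 ⟩× 16 ∷ ⟨ 16 , 29 , 35 ⟩× 111 ∷ ⟨ 16 , 29 , 38 ⟩× 21 ∷ ⟨ 16 , 29 , 39 ⟩× 1 ∷ ⟨ 16 , 30 , 36 ⟩× 1 ∷ ⟨ 16 , 31 , 36 ⟩× 17 ∷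
    ⟨ 16 , 33 , 35 ⟩× 2 ∷ ⟨ 16 , 34 , 37 ⟩× 1 ∷ ⟨ 16 , 35 , 38 ⟩× 33 ∷ ⟨ 16 , 35 , 39 ⟩× 1 ∷ ⟨ 16 , 36 , 37 ⟩× 30 ∷ ⟨ 17 , 18 , 23 ⟩× 46 ∷
    ⟨ 17 , 18 , 37 ⟩× 321 ∷ ⟨ 17 , 19 , 23 ⟩× 95 ∷ ⟨ 17 , 19 , 38 ⟩× 47 ∷ ⟨ 17 , 19 , 39 ⟩× 15 ∷ ⟨ 17 , 20 , 37 ⟩× 1 ∷ ⟨ 17 , 21 , 24 ⟩× 22 ∷
    ⟨ 17 , 21 , 26 ⟩× 19 ∷ ⟨ 17 , 21 , 34 ⟩× 211 ∷ ⟨ 17 , 22 , 39 ⟩× 16 ∷ ⟨ 17 , 24 , 27 ⟩× 1 ∷ ⟨ 17 , 24 , 28 ⟩× 231 ∷ ⟨ 17 , 24 , 38 ⟩× 18 ∷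
    ⟨ 17 , 26 , 27 ⟩× 19 ∷ ⟨ 17 , 26 , 32 ⟩× 33 ∷ ⟨ 17 , 27 , 30 ⟩× 2 ∷ ⟨ 17 , 27 , 31 ⟩× 12 ∷ ⟨ 17 , 27 , 34 ⟩× 2 ∷ ⟨ 17 , 27 , 36 ⟩× 86 ∷
    ⟨ 17 , 27 , 37 ⟩× 2 ∷ ⟨ 17 , 27 , 39 ⟩× 1 ∷ ⟨ 17 , 28 , 32 ⟩× 119 ∷ ⟨ 17 , 28 , 38 ⟩× 31 ∷ ⟨ 17 , 30 , 34 ⟩× 18 ∷ ⟨ 17 , 31 , 32 ⟩× 330 ∷
    ⟨ 17 , 31 , 34 ⟩× 178 ∷ ⟨ 17 , 31 , 35 ⟩× 26 ∷ ⟨ 17 , 31 , 38 ⟩× 1 ∷ ⟨ 17 , 32 , 34 ⟩× 119 ∷ ⟨ 17 , 32 , 36 ⟩× 43 ∷ ⟨ 17 , 35 , 36 ⟩× 17 ∷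
    ⟨ 17 , 35 , 37 ⟩× 41 ∷ ⟨ 17 , 37 , 38 ⟩× 298 ∷ ⟨ 18 , 19 , 20 ⟩× 27 ∷ ⟨ 18 , 19 , 30 ⟩× 104 ∷ ⟨ 18 , 19 , 33 ⟩× 19 ∷ ⟨ 18 , 20 , 22 ⟩× 72 ∷
    ⟨ 18 , 20 , 27 ⟩× 13 ∷ ⟨ 18 , 20 , 30 ⟩× 13 ∷ ⟨ 18 , 20 , 37 ⟩× 1 ∷ ⟨ 18 , 21 , 31 ⟩× 19 ∷ ⟨ 18 , 21 , 33 ⟩× 2 ∷ ⟨ 18 , 22 , 35 ⟩× 37 ∷
    ⟨ 18 , 22 , 36 ⟩× 20 ∷ ⟨ 18 , 23 , 29 ⟩× 15 ∷ ⟨ 18 , 24 , 35 ⟩× 11 ∷ ⟨ 18 , 24 , 39 ⟩× 37 ∷ ⟨ 18 , 25 , 27 ⟩× 158 ∷ ⟨ 18 , 25 , 31 ⟩× 279 ∷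
    ⟨ 18 , 25 , 39 ⟩× 18 ∷ ⟨ 18 , 27 , 32 ⟩× 12 ∷ ⟨ 18 , 27 , 37 ⟩× 33 ∷ ⟨ 18 , 28 , 35 ⟩× 21 ∷ ⟨ 18 , 28 , 39 ⟩× 149 ∷ ⟨ 18 , 29 , 32 ⟩× 120 ∷
    ⟨ 18 , 29 , 33 ⟩× 1 ∷ ⟨ 18 , 29 , 35 ⟩× 58 ∷ ⟨ 18 , 30 , 31 ⟩× 1 ∷ ⟨ 18 , 30 , 33 ⟩× 2 ∷ ⟨ 18 , 30 , 36 ⟩× 52 ∷ ⟨ 18 , 30 , 37 ⟩× 1 ∷
    ⟨ 18 , 31 , 33 ⟩× 139 ∷ ⟨ 18 , 31 , 36 ⟩× 1 ∷ ⟨ 18 , 31 , 37 ⟩× 3 ∷ ⟨ 18 , 31 , 38 ⟩× 16 ∷ ⟨ 18 , 32 , 33 ⟩× 1 ∷ ⟨ 18 , 32 , 38 ⟩× 2 ∷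
    ⟨ 18 , 33 , 36 ⟩× 3 ∷ ⟨ 18 , 33 , 37 ⟩× 11 ∷ ⟨ 18 , 33 , 39 ⟩× 281 ∷ ⟨ 18 , 35 , 37 ⟩× 5 ∷ ⟨ 18 , 35 , 38 ⟩× 139 ∷ ⟨ 18 , 36 , 38 ⟩× 35 ∷
    ⟨ 18 , 37 , 39 ⟩× 75 ∷ ⟨ 19 , 20 , 21 ⟩× 15 ∷ ⟨ 19 , 20 , 34 ⟩× 18 ∷ ⟨ 19 , 20 , 38 ⟩× 1 ∷ ⟨ 19 , 20 , 39 ⟩× 57 ∷ ⟨ 19 , 21 , 28 ⟩× 15 ∷
    ⟨ 19 , 21 , 32 ⟩× 20 ∷ ⟨ 19 , 21 , 36 ⟩× 2 ∷ ⟨ 19 , 22 , 26 ⟩× 25 ∷ ⟨ 19 , 22 , 36 ⟩× 1 ∷ ⟨ 19 , 23 , 26 ⟩× 38 ∷ ⟨ 19 , 23 , 33 ⟩× 304 ∷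
    ⟨ 19 , 23 , 37 ⟩× 152 ∷ ⟨ 19 , 24 , 30 ⟩× 70 ∷ ⟨ 19 , 25 , 38 ⟩× 2 ∷ ⟨ 19 , 26 , 28 ⟩× 165 ∷ ⟨ 19 , 26 , 30 ⟩× 19 ∷ ⟨ 19 , 26 , 33 ⟩× 73 ∷
    ⟨ 19 , 26 , 37 ⟩× 2 ∷ ⟨ 19 , 28 , 37 ⟩× 115 ∷ ⟨ 19 , 30 , 36 ⟩× 1 ∷ ⟨ 19 , 30 , 37 ⟩× 33 ∷ ⟨ 19 , 33 , 34 ⟩× 84 ∷ ⟨ 19 , 34 , 36 ⟩× 43 ∷
    ⟨ 19 , 34 , 37 ⟩× 1 ∷ ⟨ 19 , 37 , 39 ⟩× 186 ∷ ⟨ 19 , 38 , 39 ⟩× 15 ∷ ⟨ 20 , 21 , 27 ⟩× 1 ∷ ⟨ 20 , 21 , 38 ⟩× 1 ∷ ⟨ 20 , 22 , 24 ⟩× 13 ∷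
    ⟨ 20 , 22 , 32 ⟩× 1 ∷ ⟨ 20 , 22 , 35 ⟩× 215 ∷ ⟨ 20 , 22 , 37 ⟩× 320 ∷ ⟨ 20 , 23 , 27 ⟩× 27 ∷ ⟨ 20 , 23 , 30 ⟩× 1 ∷ ⟨ 20 , 23 , 35 ⟩× 15 ∷
    ⟨ 20 , 25 , 26 ⟩× 19 ∷ ⟨ 20 , 25 , 27 ⟩× 1 ∷ ⟨ 20 , 25 , 30 ⟩× 15 ∷ ⟨ 20 , 25 , 32 ⟩× 137 ∷ ⟨ 20 , 25 , 35 ⟩× 35 ∷ ⟨ 20 , 25 , 38 ⟩× 15 ∷
    ⟨ 20 , 26 , 32 ⟩× 3 ∷ ⟨ 20 , 27 , 33 ⟩× 56 ∷ ⟨ 20 , 27 , 37 ⟩× 295 ∷ ⟨ 20 , 29 , 38 ⟩× 13 ∷ ⟨ 20 , 30 , 34 ⟩× 78 ∷ ⟨ 20 , 30 , 35 ⟩× 54 ∷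
    ⟨ 20 , 30 , 37 ⟩× 24 ∷ ⟨ 20 , 31 , 34 ⟩× 54 ∷ ⟨ 20 , 31 , 35 ⟩× 1 ∷ ⟨ 20 , 32 , 35 ⟩× 85 ∷ ⟨ 20 , 32 , 37 ⟩× 3 ∷ ⟨ 20 , 32 , 39 ⟩× 21 ∷
    ⟨ 20 , 33 , 34 ⟩× 39 ∷ ⟨ 20 , 33 , 35 ⟩× 21 ∷ ⟨ 20 , 34 , 37 ⟩× 6 ∷ ⟨ 20 , 38 , 39 ⟩× 27 ∷ ⟨ 21 , 22 , 23 ⟩× 16 ∷ ⟨ 21 , 22 , 25 ⟩× 87 ∷
    ⟨ 21 , 22 , 28 ⟩× 203 ∷ ⟨ 21 , 22 , 31 ⟩× 16 ∷ ⟨ 21 , 22 , 35 ⟩× 1 ∷ ⟨ 21 , 22 , 36 ⟩× 1 ∷ ⟨ 21 , 22 , 39 ⟩× 2 ∷ ⟨ 21 , 23 , 30 ⟩× 1 ∷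
    ⟨ 21 , 24 , 27 ⟩× 18 ∷ ⟨ 21 , 24 , 28 ⟩× 1 ∷ ⟨ 21 , 24 , 31 ⟩× 42 ∷ ⟨ 21 , 24 , 36 ⟩× 1 ∷ ⟨ 21 , 25 , 27 ⟩× 1 ∷ ⟨ 21 , 25 , 32 ⟩× 20 ∷
    ⟨ 21 , 25 , 36 ⟩× 27 ∷ ⟨ 21 , 26 , 28 ⟩× 1 ∷ ⟨ 21 , 26 , 36 ⟩× 68 ∷ ⟨ 21 , 26 , 38 ⟩× 279 ∷ ⟨ 21 , 27 , 38 ⟩× 16 ∷ ⟨ 21 , 28 , 34 ⟩× 13 ∷
    ⟨ 21 , 28 , 39 ⟩× 27 ∷ ⟨ 21 , 30 , 35 ⟩× 20 ∷ ⟨ 21 , 33 , 38 ⟩× 261 ∷ ⟨ 21 , 34 , 35 ⟩× 58 ∷ ⟨ 21 , 34 , 36 ⟩× 2 ∷ ⟨ 21 , 34 , 39 ⟩× 95 ∷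
    ⟨ 21 , 35 , 38 ⟩× 1 ∷ ⟨ 21 , 36 , 38 ⟩× 2 ∷ ⟨ 22 , 23 , 25 ⟩× 1 ∷ ⟨ 22 , 23 , 26 ⟩× 1 ∷ ⟨ 22 , 23 , 32 ⟩× 14 ∷ ⟨ 22 , 23 , 33 ⟩× 1 ∷
    ⟨ 22 , 23 , 34 ⟩× 29 ∷ ⟨ 22 , 24 , 25 ⟩× 1 ∷ ⟨ 22 , 24 , 36 ⟩× 1 ∷ ⟨ 22 , 25 , 28 ⟩× 59 ∷ ⟨ 22 , 25 , 32 ⟩× 22 ∷ ⟨ 22 , 25 , 34 ⟩× 1 ∷
    ⟨ 22 , 26 , 27 ⟩× 20 ∷ ⟨ 22 , 26 , 29 ⟩× 15 ∷ ⟨ 22 , 28 , 39 ⟩× 1 ∷ ⟨ 22 , 29 , 33 ⟩× 32 ∷ ⟨ 22 , 29 , 39 ⟩× 62 ∷ ⟨ 22 , 31 , 33 ⟩× 18 ∷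
    ⟨ 22 , 32 , 39 ⟩× 1 ∷ ⟨ 22 , 36 , 37 ⟩× 208 ∷ ⟨ 23 , 24 , 30 ⟩× 14 ∷ ⟨ 23 , 24 , 33 ⟩× 36 ∷ ⟨ 23 , 24 , 36 ⟩× 25 ∷ ⟨ 23 , 25 , 27 ⟩× 4 ∷
    ⟨ 23 , 26 , 29 ⟩× 28 ∷ ⟨ 23 , 26 , 33 ⟩× 1 ∷ ⟨ 23 , 26 , 35 ⟩× 89 ∷ ⟨ 23 , 26 , 36 ⟩× 183 ∷ ⟨ 23 , 27 , 28 ⟩× 84 ∷ ⟨ 23 , 27 , 34 ⟩× 1 ∷
    ⟨ 23 , 27 , 38 ⟩× 35 ∷ ⟨ 23 , 28 , 33 ⟩× 1 ∷ ⟨ 23 , 29 , 32 ⟩× 68 ∷ ⟨ 23 , 29 , 33 ⟩× 16 ∷ ⟨ 23 , 30 , 34 ⟩× 312 ∷ ⟨ 23 , 30 , 35 ⟩× 172 ∷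
    ⟨ 23 , 30 , 37 ⟩× 84 ∷ ⟨ 23 , 32 , 35 ⟩× 271 ∷ ⟨ 23 , 33 , 36 ⟩× 118 ∷ ⟨ 23 , 33 , 38 ⟩× 10 ∷ ⟨ 23 , 34 , 35 ⟩× 1 ∷ ⟨ 23 , 36 , 37 ⟩× 45 ∷
    ⟨ 24 , 25 , 27 ⟩× 14 ∷ ⟨ 24 , 25 , 29 ⟩× 26 ∷ ⟨ 24 , 25 , 39 ⟩× 116 ∷ ⟨ 24 , 26 , 29 ⟩× 1 ∷ ⟨ 24 , 26 , 30 ⟩× 2 ∷ ⟨ 24 , 27 , 36 ⟩× 2 ∷
    ⟨ 24 , 28 , 29 ⟩× 126 ∷ ⟨ 24 , 28 , 31 ⟩× 3 ∷ ⟨ 24 , 28 , 38 ⟩× 2 ∷ ⟨ 24 , 28 , 39 ⟩× 14 ∷ ⟨ 24 , 30 , 33 ⟩× 19 ∷ ⟨ 24 , 31 , 36 ⟩× 16 ∷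
    ⟨ 24 , 31 , 37 ⟩× 70 ∷ ⟨ 24 , 31 , 38 ⟩× 1 ∷ ⟨ 24 , 33 , 38 ⟩× 1 ∷ ⟨ 24 , 33 , 39 ⟩× 16 ∷ ⟨ 24 , 34 , 38 ⟩× 16 ∷ ⟨ 24 , 36 , 38 ⟩× 63 ∷
    ⟨ 24 , 36 , 39 ⟩× 1 ∷ ⟨ 24 , 37 , 38 ⟩× 27 ∷ ⟨ 24 , 37 , 39 ⟩× 1 ∷ ⟨ 25 , 26 , 38 ⟩× 68 ∷ ⟨ 25 , 27 , 29 ⟩× 1 ∷ ⟨ 25 , 27 , 31 ⟩× 1 ∷
    ⟨ 25 , 27 , 36 ⟩× 1 ∷ ⟨ 25 , 27 , 38 ⟩× 50 ∷ ⟨ 25 , 27 , 39 ⟩× 1 ∷ ⟨ 25 , 28 , 31 ⟩× 12 ∷ ⟨ 25 , 28 , 37 ⟩× 1 ∷ ⟨ 25 , 29 , 34 ⟩× 18 ∷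
    ⟨ 25 , 29 , 36 ⟩× 12 ∷ ⟨ 25 , 31 , 34 ⟩× 25 ∷ ⟨ 25 , 31 , 35 ⟩× 15 ∷ ⟨ 25 , 32 , 38 ⟩× 5 ∷ ⟨ 25 , 32 , 39 ⟩× 54 ∷ ⟨ 25 , 34 , 35 ⟩× 1 ∷
    ⟨ 25 , 34 , 38 ⟩× 23 ∷ ⟨ 25 , 35 , 38 ⟩× 2 ∷ ⟨ 25 , 37 , 39 ⟩× 1 ∷ ⟨ 26 , 27 , 28 ⟩× 43 ∷ ⟨ 26 , 27 , 36 ⟩× 5 ∷ ⟨ 26 , 27 , 38 ⟩× 1 ∷
    ⟨ 26 , 27 , 39 ⟩× 66 ∷ ⟨ 26 , 30 , 31 ⟩× 1 ∷ ⟨ 26 , 31 , 32 ⟩× 71 ∷ ⟨ 26 , 31 , 35 ⟩× 3 ∷ ⟨ 26 , 31 , 38 ⟩× 23 ∷ ⟨ 26 , 32 , 35 ⟩× 1 ∷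
    ⟨ 26 , 33 , 35 ⟩× 57 ∷ ⟨ 26 , 33 , 37 ⟩× 34 ∷ ⟨ 26 , 33 , 38 ⟩× 16 ∷ ⟨ 26 , 35 , 39 ⟩× 15 ∷ ⟨ 26 , 36 , 37 ⟩× 20 ∷ ⟨ 26 , 37 , 38 ⟩× 132 ∷
    ⟨ 26 , 37 , 39 ⟩× 1 ∷ ⟨ 27 , 28 , 31 ⟩× 22 ∷ ⟨ 27 , 28 , 38 ⟩× 19 ∷ ⟨ 27 , 29 , 33 ⟩× 2 ∷ ⟨ 27 , 29 , 36 ⟩× 1 ∷ ⟨ 27 , 29 , 39 ⟩× 1 ∷
    ⟨ 27 , 30 , 32 ⟩× 1 ∷ ⟨ 27 , 30 , 36 ⟩× 180 ∷ ⟨ 27 , 30 , 39 ⟩× 31 ∷ ⟨ 27 , 31 , 32 ⟩× 41 ∷ ⟨ 27 , 31 , 36 ⟩× 2 ∷ ⟨ 27 , 31 , 37 ⟩× 139 ∷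
    ⟨ 27 , 33 , 34 ⟩× 11 ∷ ⟨ 27 , 33 , 37 ⟩× 111 ∷ ⟨ 27 , 34 , 37 ⟩× 15 ∷ ⟨ 27 , 36 , 39 ⟩× 2 ∷ ⟨ 28 , 29 , 30 ⟩× 30 ∷ ⟨ 28 , 30 , 31 ⟩× 2 ∷
    ⟨ 28 , 31 , 34 ⟩× 3 ∷ ⟨ 28 , 31 , 37 ⟩× 30 ∷ ⟨ 28 , 31 , 38 ⟩× 1 ∷ ⟨ 28 , 32 , 33 ⟩× 12 ∷ ⟨ 28 , 32 , 35 ⟩× 1 ∷ ⟨ 28 , 32 , 37 ⟩× 15 ∷
    ⟨ 28 , 33 , 37 ⟩× 13 ∷ ⟨ 28 , 37 , 39 ⟩× 58 ∷ ⟨ 29 , 30 , 35 ⟩× 261 ∷ ⟨ 29 , 30 , 39 ⟩× 17 ∷ ⟨ 29 , 31 , 38 ⟩× 4 ∷ ⟨ 29 , 32 , 35 ⟩× 17 ∷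
    ⟨ 29 , 32 , 38 ⟩× 14 ∷ ⟨ 29 , 33 , 39 ⟩× 104 ∷ ⟨ 29 , 34 , 36 ⟩× 18 ∷ ⟨ 29 , 34 , 39 ⟩× 32 ∷ ⟨ 29 , 38 , 39 ⟩× 1 ∷ ⟨ 30 , 31 , 32 ⟩× 13 ∷
    ⟨ 30 , 31 , 33 ⟩× 108 ∷ ⟨ 30 , 31 , 34 ⟩× 153 ∷ ⟨ 30 , 32 , 33 ⟩× 11 ∷ ⟨ 30 , 33 , 34 ⟩× 1 ∷ ⟨ 30 , 35 , 39 ⟩× 124 ∷ ⟨ 31 , 32 , 35 ⟩× 169 ∷
    ⟨ 31 , 32 , 37 ⟩× 18 ∷ ⟨ 31 , 32 , 38 ⟩× 2 ∷ ⟨ 31 , 33 , 36 ⟩× 235 ∷ ⟨ 31 , 34 , 35 ⟩× 16 ∷ ⟨ 31 , 34 , 38 ⟩× 1 ∷ ⟨ 31 , 35 , 38 ⟩× 1 ∷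
    ⟨ 32 , 34 , 37 ⟩× 117 ∷ ⟨ 32 , 34 , 39 ⟩× 42 ∷ ⟨ 32 , 35 , 38 ⟩× 1 ∷ ⟨ 32 , 36 , 38 ⟩× 1 ∷ ⟨ 33 , 36 , 39 ⟩× 45 ∷ ⟨ 34 , 35 , 38 ⟩× 243 ∷
    ⟨ 34 , 35 , 39 ⟩× 16 ∷ ⟨ 34 , 37 , 38 ⟩× 61 ∷ ⟨ 34 , 37 , 39 ⟩× 2 ∷ ⟨ 36 , 37 , 39 ⟩× 1 ∷ ⟨ 36 , 38 , 39 ⟩× 13 ∷ ⟨ 37 , 38 , 39 ⟩× 1 ∷ []

pairTable : Vec (Fin 40 × Fin 40) 700
pairTable =
    (# 9 , # 29) ∷ (# 12 , # 14) ∷ (# 19 , # 31) ∷ (# 24 , # 26) ∷ (# 5 , # 12) ∷ (# 23 , # 25) ∷ (# 0 , # 18) ∷ (# 9 , # 16) ∷ (# 9 , # 31) ∷ (# 3 , # 13) ∷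
    (# 5 , # 19) ∷ (# 24 , # 35) ∷ (# 11 , # 39) ∷ (# 2 , # 17) ∷ (# 6 , # 17) ∷ (# 2 , # 32) ∷ (# 24 , # 34) ∷ (# 0 , # 9) ∷ (# 35 , # 36) ∷ (# 2 , # 38) ∷
    (# 17 , # 29) ∷ (# 12 , # 31) ∷ (# 18 , # 21) ∷ (# 1 , # 29) ∷ (# 29 , # 31) ∷ (# 5 , # 20) ∷ (# 3 , # 23) ∷ (# 28 , # 33) ∷ (# 6 , # 7) ∷ (# 1 , # 8) ∷
    (# 28 , # 34) ∷ (# 4 , # 38) ∷ (# 7 , # 20) ∷ (# 15 , # 17) ∷ (# 4 , # 35) ∷ (# 32 , # 33) ∷ (# 22 , # 31) ∷ (# 12 , # 13) ∷ (# 1 , # 12) ∷ (# 26 , # 30) ∷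
    (# 19 , # 32) ∷ (# 12 , # 39) ∷ (# 21 , # 32) ∷ (# 10 , # 20) ∷ (# 12 , # 37) ∷ (# 20 , # 24) ∷ (# 4 , # 14) ∷ (# 10 , # 32) ∷ (# 3 , # 14) ∷ (# 10 , # 35) ∷
    (# 14 , # 28) ∷ (# 13 , # 19) ∷ (# 19 , # 21) ∷ (# 12 , # 19) ∷ (# 32 , # 38) ∷ (# 4 , # 32) ∷ (# 19 , # 22) ∷ (# 38 , # 39) ∷ (# 20 , # 38) ∷ (# 26 , # 29) ∷
    (# 28 , # 30) ∷ (# 20 , # 23) ∷ (# 8 , # 26) ∷ (# 16 , # 36) ∷ (# 0 , # 21) ∷ (# 2 , # 30) ∷ (# 1 , # 31) ∷ (# 0 , # 3) ∷ (# 9 , # 32) ∷ (# 13 , # 20) ∷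
    (# 25 , # 35) ∷ (# 20 , # 26) ∷ (# 4 , # 18) ∷ (# 0 , # 11) ∷ (# 22 , # 33) ∷ (# 27 , # 29) ∷ (# 16 , # 38) ∷ (# 28 , # 31) ∷ (# 8 , # 19) ∷ (# 2 , # 28) ∷
    (# 10 , # 14) ∷ (# 30 , # 32) ∷ (# 13 , # 27) ∷ (# 27 , # 32) ∷ (# 20 , # 29) ∷ (# 1 , # 7) ∷ (# 23 , # 38) ∷ (# 23 , # 24) ∷ (# 29 , # 36) ∷ (# 8 , # 21) ∷
    (# 10 , # 11) ∷ (# 22 , # 32) ∷ (# 3 , # 22) ∷ (# 31 , # 38) ∷ (# 34 , # 36) ∷ (# 4 , # 5) ∷ (# 2 , # 33) ∷ (# 9 , # 23) ∷ (# 15 , # 27) ∷ (# 9 , # 27) ∷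
    (# 1 , # 6) ∷ (# 14 , # 34) ∷ (# 25 , # 28) ∷ (# 17 , # 35) ∷ (# 6 , # 34) ∷ (# 1 , # 16) ∷ (# 27 , # 34) ∷ (# 6 , # 35) ∷ (# 28 , # 38) ∷ (# 5 , # 8) ∷
    (# 25 , # 29) ∷ (# 4 , # 19) ∷ (# 22 , # 26) ∷ (# 9 , # 12) ∷ (# 24 , # 27) ∷ (# 4 , # 31) ∷ (# 14 , # 37) ∷ (# 20 , # 21) ∷ (# 19 , # 20) ∷ (# 9 , # 37) ∷
    (# 15 , # 33) ∷ (# 8 , # 31) ∷ (# 16 , # 37) ∷ (# 19 , # 29) ∷ (# 24 , # 33) ∷ (# 8 , # 22) ∷ (# 8 , # 39) ∷ (# 22 , # 29) ∷ (# 7 , # 24) ∷ (# 33 , # 35) ∷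
    (# 10 , # 33) ∷ (# 2 , # 3) ∷ (# 10 , # 29) ∷ (# 1 , # 10) ∷ (# 27 , # 39) ∷ (# 1 , # 20) ∷ (# 17 , # 22) ∷ (# 13 , # 35) ∷ (# 9 , # 10) ∷ (# 6 , # 31) ∷
    (# 24 , # 30) ∷ (# 8 , # 33) ∷ (# 6 , # 9) ∷ (# 28 , # 35) ∷ (# 9 , # 20) ∷ (# 26 , # 31) ∷ (# 2 , # 5) ∷ (# 35 , # 37) ∷ (# 15 , # 35) ∷ (# 0 , # 1) ∷
    (# 6 , # 16) ∷ (# 10 , # 38) ∷ (# 1 , # 28) ∷ (# 36 , # 38) ∷ (# 16 , # 23) ∷ (# 12 , # 21) ∷ (# 22 , # 34) ∷ (# 4 , # 29) ∷ (# 11 , # 38) ∷ (# 22 , # 24) ∷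
    (# 12 , # 38) ∷ (# 0 , # 35) ∷ (# 15 , # 22) ∷ (# 11 , # 16) ∷ (# 1 , # 14) ∷ (# 13 , # 39) ∷ (# 9 , # 11) ∷ (# 1 , # 22) ∷ (# 30 , # 37) ∷ (# 33 , # 34) ∷
    (# 36 , # 39) ∷ (# 18 , # 23) ∷ (# 17 , # 19) ∷ (# 1 , # 35) ∷ (# 23 , # 27) ∷ (# 15 , # 24) ∷ (# 13 , # 30) ∷ (# 7 , # 29) ∷ (# 7 , # 8) ∷ (# 17 , # 39) ∷
    (# 23 , # 29) ∷ (# 13 , # 16) ∷ (# 10 , # 19) ∷ (# 18 , # 20) ∷ (# 11 , # 33) ∷ (# 16 , # 25) ∷ (# 21 , # 31) ∷ (# 3 , # 21) ∷ (# 12 , # 30) ∷ (# 2 , # 16) ∷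
    (# 34 , # 39) ∷ (# 13 , # 26) ∷ (# 17 , # 20) ∷ (# 13 , # 17) ∷ (# 3 , # 12) ∷ (# 7 , # 28) ∷ (# 7 , # 19) ∷ (# 21 , # 25) ∷ (# 26 , # 33) ∷ (# 2 , # 14) ∷
    (# 5 , # 26) ∷ (# 5 , # 33) ∷ (# 26 , # 35) ∷ (# 8 , # 35) ∷ (# 14 , # 32) ∷ (# 1 , # 15) ∷ (# 25 , # 36) ∷ (# 4 , # 33) ∷ (# 16 , # 22) ∷ (# 19 , # 38) ∷
    (# 20 , # 34) ∷ (# 7 , # 34) ∷ (# 21 , # 36) ∷ (# 2 , # 31) ∷ (# 3 , # 7) ∷ (# 20 , # 31) ∷ (# 2 , # 12) ∷ (# 6 , # 11) ∷ (# 10 , # 13) ∷ (# 0 , # 37) ∷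
    (# 9 , # 18) ∷ (# 17 , # 26) ∷ (# 11 , # 28) ∷ (# 0 , # 12) ∷ (# 2 , # 29) ∷ (# 6 , # 33) ∷ (# 8 , # 17) ∷ (# 5 , # 14) ∷ (# 0 , # 10) ∷ (# 8 , # 27) ∷
    (# 4 , # 13) ∷ (# 6 , # 24) ∷ (# 28 , # 37) ∷ (# 5 , # 27) ∷ (# 12 , # 18) ∷ (# 17 , # 30) ∷ (# 29 , # 39) ∷ (# 27 , # 38) ∷ (# 18 , # 19) ∷ (# 6 , # 8) ∷
    (# 18 , # 29) ∷ (# 6 , # 37) ∷ (# 7 , # 9) ∷ (# 8 , # 34) ∷ (# 3 , # 18) ∷ (# 3 , # 29) ∷ (# 11 , # 25) ∷ (# 6 , # 27) ∷ (# 4 , # 34) ∷ (# 10 , # 24) ∷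
    (# 20 , # 39) ∷ (# 6 , # 26) ∷ (# 8 , # 11) ∷ (# 12 , # 29) ∷ (# 18 , # 36) ∷ (# 7 , # 13) ∷ (# 21 , # 27) ∷ (# 11 , # 20) ∷ (# 14 , # 17) ∷ (# 12 , # 35) ∷
    (# 25 , # 26) ∷ (# 12 , # 15) ∷ (# 27 , # 28) ∷ (# 2 , # 11) ∷ (# 2 , # 27) ∷ (# 21 , # 35) ∷ (# 11 , # 31) ∷ (# 1 , # 19) ∷ (# 18 , # 27) ∷ (# 4 , # 27) ∷
    (# 4 , # 6) ∷ (# 0 , # 23) ∷ (# 5 , # 28) ∷ (# 0 , # 6) ∷ (# 9 , # 22) ∷ (# 0 , # 36) ∷ (# 2 , # 20) ∷ (# 1 , # 39) ∷ (# 24 , # 31) ∷ (# 31 , # 37) ∷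
    (# 10 , # 21) ∷ (# 8 , # 29) ∷ (# 33 , # 37) ∷ (# 13 , # 25) ∷ (# 24 , # 37) ∷ (# 14 , # 20) ∷ (# 26 , # 32) ∷ (# 8 , # 28) ∷ (# 8 , # 15) ∷ (# 5 , # 17) ∷
    (# 12 , # 32) ∷ (# 11 , # 17) ∷ (# 4 , # 23) ∷ (# 30 , # 33) ∷ (# 4 , # 10) ∷ (# 24 , # 39) ∷ (# 7 , # 32) ∷ (# 3 , # 39) ∷ (# 9 , # 39) ∷ (# 10 , # 12) ∷
    (# 0 , # 30) ∷ (# 19 , # 34) ∷ (# 3 , # 31) ∷ (# 16 , # 29) ∷ (# 29 , # 33) ∷ (# 10 , # 37) ∷ (# 20 , # 25) ∷ (# 26 , # 27) ∷ (# 0 , # 20) ∷ (# 5 , # 24) ∷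
    (# 21 , # 30) ∷ (# 29 , # 32) ∷ (# 3 , # 28) ∷ (# 3 , # 25) ∷ (# 11 , # 34) ∷ (# 30 , # 31) ∷ (# 15 , # 36) ∷ (# 32 , # 36) ∷ (# 1 , # 36) ∷ (# 2 , # 21) ∷
    (# 25 , # 39) ∷ (# 32 , # 34) ∷ (# 3 , # 9) ∷ (# 35 , # 39) ∷ (# 0 , # 31) ∷ (# 16 , # 20) ∷ (# 23 , # 37) ∷ (# 15 , # 28) ∷ (# 19 , # 26) ∷ (# 11 , # 26) ∷
    (# 16 , # 30) ∷ (# 2 , # 7) ∷ (# 15 , # 29) ∷ (# 1 , # 30) ∷ (# 0 , # 13) ∷ (# 7 , # 10) ∷ (# 25 , # 38) ∷ (# 29 , # 38) ∷ (# 16 , # 34) ∷ (# 3 , # 6) ∷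
    (# 9 , # 15) ∷ (# 11 , # 14) ∷ (# 11 , # 23) ∷ (# 17 , # 27) ∷ (# 29 , # 34) ∷ (# 4 , # 15) ∷ (# 17 , # 36) ∷ (# 10 , # 36) ∷ (# 11 , # 13) ∷ (# 23 , # 28) ∷
    (# 11 , # 37) ∷ (# 22 , # 25) ∷ (# 4 , # 39) ∷ (# 3 , # 4) ∷ (# 18 , # 30) ∷ (# 25 , # 37) ∷ (# 5 , # 10) ∷ (# 10 , # 28) ∷ (# 16 , # 26) ∷ (# 5 , # 15) ∷
    (# 27 , # 36) ∷ (# 5 , # 18) ∷ (# 21 , # 22) ∷ (# 1 , # 37) ∷ (# 16 , # 27) ∷ (# 4 , # 25) ∷ (# 26 , # 36) ∷ (# 2 , # 6) ∷ (# 14 , # 29) ∷ (# 15 , # 38) ∷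
    (# 14 , # 21) ∷ (# 20 , # 30) ∷ (# 37 , # 39) ∷ (# 5 , # 11) ∷ (# 0 , # 4) ∷ (# 28 , # 39) ∷ (# 7 , # 17) ∷ (# 20 , # 33) ∷ (# 5 , # 9) ∷ (# 4 , # 16) ∷
    (# 14 , # 15) ∷ (# 15 , # 16) ∷ (# 12 , # 23) ∷ (# 3 , # 24) ∷ (# 19 , # 39) ∷ (# 12 , # 26) ∷ (# 14 , # 26) ∷ (# 1 , # 27) ∷ (# 12 , # 17) ∷ (# 15 , # 37) ∷
    (# 25 , # 30) ∷ (# 16 , # 28) ∷ (# 1 , # 5) ∷ (# 2 , # 4) ∷ (# 6 , # 12) ∷ (# 4 , # 17) ∷ (# 34 , # 37) ∷ (# 17 , # 38) ∷ (# 0 , # 17) ∷ (# 0 , # 25) ∷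
    (# 0 , # 2) ∷ (# 3 , # 26) ∷ (# 14 , # 31) ∷ (# 10 , # 39) ∷ (# 10 , # 30) ∷ (# 9 , # 26) ∷ (# 7 , # 37) ∷ (# 1 , # 2) ∷ (# 7 , # 25) ∷ (# 13 , # 31) ∷
    (# 3 , # 37) ∷ (# 4 , # 37) ∷ (# 11 , # 36) ∷ (# 1 , # 3) ∷ (# 12 , # 25) ∷ (# 5 , # 34) ∷ (# 36 , # 37) ∷ (# 0 , # 26) ∷ (# 9 , # 30) ∷ (# 8 , # 37) ∷
    (# 8 , # 12) ∷ (# 16 , # 19) ∷ (# 21 , # 34) ∷ (# 0 , # 38) ∷ (# 15 , # 21) ∷ (# 2 , # 25) ∷ (# 32 , # 39) ∷ (# 17 , # 18) ∷ (# 0 , # 34) ∷ (# 5 , # 35) ∷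
    (# 20 , # 35) ∷ (# 16 , # 31) ∷ (# 20 , # 32) ∷ (# 15 , # 32) ∷ (# 28 , # 32) ∷ (# 10 , # 15) ∷ (# 6 , # 25) ∷ (# 14 , # 18) ∷ (# 1 , # 32) ∷ (# 32 , # 37) ∷
    (# 17 , # 23) ∷ (# 7 , # 22) ∷ (# 7 , # 26) ∷ (# 18 , # 22) ∷ (# 5 , # 25) ∷ (# 27 , # 33) ∷ (# 0 , # 27) ∷ (# 24 , # 25) ∷ (# 17 , # 21) ∷ (# 15 , # 26) ∷
    (# 14 , # 16) ∷ (# 3 , # 15) ∷ (# 8 , # 30) ∷ (# 0 , # 19) ∷ (# 3 , # 32) ∷ (# 6 , # 39) ∷ (# 21 , # 23) ∷ (# 3 , # 20) ∷ (# 7 , # 33) ∷ (# 4 , # 22) ∷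
    (# 2 , # 35) ∷ (# 14 , # 25) ∷ (# 13 , # 33) ∷ (# 24 , # 28) ∷ (# 7 , # 27) ∷ (# 5 , # 31) ∷ (# 18 , # 28) ∷ (# 5 , # 30) ∷ (# 7 , # 38) ∷ (# 3 , # 30) ∷
    (# 1 , # 11) ∷ (# 33 , # 36) ∷ (# 13 , # 23) ∷ (# 19 , # 25) ∷ (# 16 , # 33) ∷ (# 23 , # 32) ∷ (# 9 , # 34) ∷ (# 8 , # 10) ∷ (# 2 , # 13) ∷ (# 18 , # 37) ∷
    (# 18 , # 38) ∷ (# 17 , # 28) ∷ (# 15 , # 18) ∷ (# 0 , # 14) ∷ (# 4 , # 21) ∷ (# 9 , # 28) ∷ (# 34 , # 35) ∷ (# 5 , # 16) ∷ (# 8 , # 23) ∷ (# 23 , # 26) ∷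
    (# 8 , # 25) ∷ (# 23 , # 36) ∷ (# 10 , # 22) ∷ (# 25 , # 32) ∷ (# 9 , # 21) ∷ (# 4 , # 11) ∷ (# 34 , # 38) ∷ (# 4 , # 9) ∷ (# 5 , # 22) ∷ (# 2 , # 15) ∷
    (# 13 , # 36) ∷ (# 13 , # 38) ∷ (# 12 , # 24) ∷ (# 24 , # 38) ∷ (# 21 , # 24) ∷ (# 21 , # 33) ∷ (# 14 , # 24) ∷ (# 2 , # 9) ∷ (# 26 , # 39) ∷ (# 19 , # 28) ∷
    (# 13 , # 22) ∷ (# 9 , # 13) ∷ (# 13 , # 14) ∷ (# 14 , # 19) ∷ (# 7 , # 35) ∷ (# 9 , # 19) ∷ (# 1 , # 24) ∷ (# 18 , # 24) ∷ (# 31 , # 33) ∷ (# 14 , # 36) ∷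
    (# 27 , # 30) ∷ (# 14 , # 23) ∷ (# 29 , # 30) ∷ (# 14 , # 33) ∷ (# 5 , # 36) ∷ (# 11 , # 29) ∷ (# 6 , # 29) ∷ (# 6 , # 13) ∷ (# 1 , # 38) ∷ (# 4 , # 8) ∷
    (# 22 , # 36) ∷ (# 9 , # 24) ∷ (# 0 , # 29) ∷ (# 1 , # 26) ∷ (# 21 , # 28) ∷ (# 12 , # 22) ∷ (# 3 , # 38) ∷ (# 7 , # 21) ∷ (# 37 , # 38) ∷ (# 14 , # 27) ∷
    (# 16 , # 17) ∷ (# 0 , # 33) ∷ (# 8 , # 20) ∷ (# 13 , # 15) ∷ (# 2 , # 23) ∷ (# 11 , # 22) ∷ (# 6 , # 32) ∷ (# 16 , # 18) ∷ (# 10 , # 25) ∷ (# 1 , # 23) ∷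
    (# 18 , # 32) ∷ (# 0 , # 15) ∷ (# 8 , # 38) ∷ (# 31 , # 34) ∷ (# 18 , # 35) ∷ (# 1 , # 4) ∷ (# 16 , # 21) ∷ (# 7 , # 14) ∷ (# 18 , # 31) ∷ (# 10 , # 16) ∷
    (# 26 , # 38) ∷ (# 5 , # 32) ∷ (# 21 , # 26) ∷ (# 18 , # 33) ∷ (# 9 , # 38) ∷ (# 25 , # 27) ∷ (# 3 , # 34) ∷ (# 16 , # 39) ∷ (# 3 , # 8) ∷ (# 19 , # 37) ∷
    (# 5 , # 38) ∷ (# 1 , # 13) ∷ (# 26 , # 28) ∷ (# 22 , # 37) ∷ (# 15 , # 25) ∷ (# 30 , # 36) ∷ (# 11 , # 12) ∷ (# 33 , # 38) ∷ (# 2 , # 24) ∷ (# 18 , # 39) ∷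
    (# 11 , # 32) ∷ (# 5 , # 7) ∷ (# 1 , # 34) ∷ (# 3 , # 16) ∷ (# 23 , # 35) ∷ (# 6 , # 28) ∷ (# 4 , # 26) ∷ (# 18 , # 25) ∷ (# 22 , # 28) ∷ (# 31 , # 35) ∷
    (# 22 , # 27) ∷ (# 20 , # 27) ∷ (# 4 , # 24) ∷ (# 0 , # 22) ∷ (# 6 , # 10) ∷ (# 22 , # 23) ∷ (# 8 , # 14) ∷ (# 15 , # 19) ∷ (# 7 , # 30) ∷ (# 7 , # 11) ∷
    (# 3 , # 10) ∷ (# 8 , # 9) ∷ (# 6 , # 36) ∷ (# 3 , # 36) ∷ (# 28 , # 29) ∷ (# 25 , # 31) ∷ (# 13 , # 34) ∷ (# 7 , # 36) ∷ (# 19 , # 23) ∷ (# 0 , # 7) ∷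
    (# 11 , # 15) ∷ (# 4 , # 7) ∷ (# 13 , # 32) ∷ (# 13 , # 24) ∷ (# 17 , # 34) ∷ (# 19 , # 24) ∷ (# 2 , # 8) ∷ (# 35 , # 38) ∷ (# 15 , # 34) ∷ (# 19 , # 30) ∷
    (# 15 , # 30) ∷ (# 22 , # 39) ∷ (# 30 , # 34) ∷ (# 11 , # 30) ∷ (# 17 , # 24) ∷ (# 8 , # 13) ∷ (# 0 , # 5) ∷ (# 22 , # 35) ∷ (# 12 , # 16) ∷ (# 0 , # 28) ∷
    (# 32 , # 35) ∷ (# 10 , # 17) ∷ (# 9 , # 36) ∷ (# 10 , # 23) ∷ (# 3 , # 33) ∷ (# 14 , # 35) ∷ (# 7 , # 16) ∷ (# 11 , # 18) ∷ (# 12 , # 27) ∷ (# 25 , # 34) ∷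
    (# 6 , # 20) ∷ (# 1 , # 21) ∷ (# 5 , # 23) ∷ (# 2 , # 39) ∷ (# 27 , # 31) ∷ (# 23 , # 34) ∷ (# 6 , # 19) ∷ (# 5 , # 39) ∷ (# 29 , # 35) ∷ (# 10 , # 31) ∷
    (# 3 , # 5) ∷ (# 6 , # 23) ∷ (# 6 , # 21) ∷ (# 14 , # 39) ∷ (# 11 , # 24) ∷ (# 26 , # 37) ∷ (# 20 , # 22) ∷ (# 16 , # 35) ∷ (# 2 , # 19) ∷ (# 13 , # 28) ∷
    (# 17 , # 32) ∷ (# 5 , # 6) ∷ (# 1 , # 18) ∷ (# 20 , # 37) ∷ (# 23 , # 33) ∷ (# 19 , # 33) ∷ (# 0 , # 39) ∷ (# 21 , # 39) ∷ (# 2 , # 37) ∷ (# 12 , # 33) ∷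
    (# 15 , # 20) ∷ (# 11 , # 21) ∷ (# 12 , # 34) ∷ (# 8 , # 36) ∷ (# 21 , # 38) ∷ (# 31 , # 32) ∷ (# 10 , # 27) ∷ (# 31 , # 36) ∷ (# 24 , # 36) ∷ (# 27 , # 37) ∷
    (# 7 , # 18) ∷ (# 9 , # 14) ∷ (# 17 , # 37) ∷ (# 30 , # 35) ∷ (# 8 , # 18) ∷ (# 30 , # 39) ∷ (# 17 , # 31) ∷ (# 7 , # 12) ∷ (# 6 , # 15) ∷ (# 6 , # 18) ∷
    (# 23 , # 30) ∷ (# 3 , # 17) ∷ (# 13 , # 18) ∷ (# 4 , # 30) ∷ (# 24 , # 29) ∷ (# 9 , # 35) ∷ (# 2 , # 22) ∷ (# 33 , # 39) ∷ (# 19 , # 36) ∷ (# 2 , # 36) ∷ []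

pairOf : ℕ → Fin 40 × Fin 40
pairOf k = lookup pairTable (k mod 700)

proposition4p7 : SBGDD 0 5 8
proposition4p7 =
  fromLabelling (blocks triples) frequencies (entry-frequencyMatrix triples)
    (from-yes (all? λ i → groupCount group i ≟ℕ 5))
    -- Without the explicit size the decision is evaluated before the size is solved,
    -- and the check blows up.
    (blocks-size (from-yes (All.all? (λ t → ∣ block {40} t ∣ ≟ℕ 3) triples)))
    (from-yes (pairConditions? frequencies))
    (from-yes (allAttained? frequencies))
  where
  open FrequencyLabelling {5} {8} 0 group pairOf
  frequencies : Fin 40 → Fin 40 → ℕ
  frequencies = entry (frequencyMatrix triples)
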